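{- Let $s,k,q$ be positive integers and define $h(t)=h_{s,k}(t)=\sum_{\deg Y\le k-1}\sum_{\deg Z\le s-1}E(tYZ)$ for $t\in\mathbb{P}$, where $Y,Z$ range over $\mathbb{F}_2[T]$. Then for every $t\in\mathbb{P}$, $$h(t)=2^{k+s-r(D_{s\times k}(t))},$$ and $$\int_{\mathbb{P}}h^{q}(t)\,dt=2^{(q-1)(k+s)+1}\sum_{i=0}^{s}\Gamma_i^{s\times k}2^{ -qi}.$$ Moreover, if $R$ denotes the number of tuples $(Y_1,Z_1,\ldots,Y_q,Z_q)$ of polynomials in $\mathbb{F}_2[T]$ with $\deg Y_i\le k-1$, $\deg Z_i\le s-1$ ($1\le i\le q$) satisfying $Y_1Z_1+Y_2Z_2+\cdots+Y_qZ_q=0$, then $R=\int_{\mathbb{P}}h^{q}(t)\,dt$.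
   Context: $\mathbb{K}=\mathbb{F}_2((T^{ -1}))$ is the field of formal Laurent series $t=\sum_{i\ge -n}\alpha_iT^{ -i}$ ($\alpha_i\in\mathbb{F}_2$) with $|t|=2^{\deg t}$. $\mathbb{P}=\{t\in\mathbb{K}:|t|<1\}=\{\sum_{i\ge1}\alpha_iT^{ -i}\}$ is the unit interval, with Haar measure $dt$ normalized so that $\int_{\mathbb{P}}dt=1$ (i.e. the coefficients $\alpha_1,\alpha_2,\dots$ are independent uniform bits). $E:\mathbb{K}\to\{\pm1\}$ is the character $E(t)=(-1)^{\alpha_1}$, $\alpha_1$ being the coefficient of $T^{ -1}$ in $t$. The zero polynomial has degree $-\infty$, so degree bounds include $0$. For $t=\sum_{i\ge1}\alpha_iT^{ -i}\in\mathbb{P}$ and positive integers $a,b$, $D_{a\times b}(t)$ is the $a\times b$ persymmetric (Hankel) matrix $(\alpha_{i+j-1})_{1\le i\le a,1\le j\le b}$ over $\mathbb{F}_2$; $r(\cdot)$ is rank over $\mathbb{F}_2$. $\Gamma_i^{a\times b}$ is the number of $a\times b$ persymmetric matrices over $\mathbb{F}_2$ (matrices $(\alpha_{i+j-1})$, $(\alpha_1,\dots,\alpha_{a+b-1})\in\mathbb{F}_2^{a+b-1}$) of rank $i$. -}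

module Defs where

open import Data.Bool using (Bool; true; false; _∧_; _∨_; _xor_; not; if_then_else_)
open import Data.Nat as ℕ using (ℕ; zero; suc; _⊔_; _≡ᵇ_)
open import Data.Nat.Properties using (m^n≢0)
open import Data.Integer as ℤ using (ℤ; +_; -_)
open import Data.Rational as ℚ using (ℚ; _/_)
open import Data.Fin using (Fin)
open import Data.Vec as V using (Vec; []; _∷_)
open import Data.List as L using (List; []; _∷_; _++_; length; filter; upTo)
open import Data.Product using (_×_; _,_)
open import Relation.Nullary.Decidable using (Dec)
open import Data.Bool.Properties using (T?)
open import Function using (_∘_; const)
open import Data.Bool.ListAction using (all; any)

allVecOf : {A : Set} → List A → (n : ℕ) → List (Vec A n)
allVecOf xs zero    = [] ∷ []
allVecOf xs (suc n) = L.concatMap (λ x → L.map (x ∷_) (allVecOf xs n)) xs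

-- all of 𝔽₂ⁿ (𝔽₂ = Bool, false = 0, true = 1)
allVec : (n : ℕ) → List (Vec Bool n)
allVec = allVecOf (false ∷ true ∷ [])

countB : {A : Set} → (A → Bool) → List A → ℕ
countB p xs = length (filter (T? ∘ p) xs)

-- Points of ℙ: t = Σ_{i≥1} α_i T^{-i}, represented as the stream
-- of coefficients  t i = α_{i+1}  (i = 0,1,2,...).

ℙ : Set
ℙ = ℕ → Bool

ext : {N : ℕ} → Vec Bool N → ℙ
ext []       i       = false
ext (a ∷ as) zero    = a
ext (a ∷ as) (suc i) = ext as i

-- Polynomials in 𝔽₂[T] as coefficient lists (constant term first)

Poly : Set
Poly = List Bool

addP : Poly → Poly → Poly
addP []       ys       = ys
addP (x ∷ xs) []       = x ∷ xs
addP (x ∷ xs) (y ∷ ys) = (x xor y) ∷ addP xs ys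

mulP : Poly → Poly → Poly
mulP []       ys = []
mulP (x ∷ xs) ys = addP (if x then ys else L.map (const false) ys) (false ∷ mulP xs ys)

isZeroP : Poly → Bool
isZeroP = all not

-- a polynomial of degree ≤ n-1 (including 0) is a coefficient vector of length n
toPoly : {n : ℕ} → Vec Bool n → Poly
toPoly = V.toList

-- coefficient of T^{-1} in t·P, for t ∈ ℙ and P a polynomial:
-- Σ_j α_{j+1} p_j  (mod 2)
coeffNeg1From : ℙ → ℕ → Poly → Bool
coeffNeg1From t j []       = false
coeffNeg1From t j (p ∷ ps) = (t j ∧ p) xor coeffNeg1From t (suc j) ps

coeffNeg1 : ℙ → Poly → Bool
coeffNeg1 t = coeffNeg1From t 0

E : ℙ → Poly → ℤ
E t P = if coeffNeg1 t P then - (+ 1) else + 1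

sumℤ : List ℤ → ℤ
sumℤ = L.foldr ℤ._+_ (+ 0)

h : (s k : ℕ) → ℙ → ℤ
h s k t = sumℤ (L.concatMap (λ Y → L.map (λ Z → E t (mulP (toPoly Y) (toPoly Z))) (allVec s)) (allVec k))

Mat : ℕ → ℕ → Set
Mat a b = Vec (Vec Bool b) a

-- persymmetric (Hankel) matrix D_{a×b}(t) = (α_{i+j-1}); with 0-based
-- indices i,j this is t (i + j)
D : (a b : ℕ) → ℙ → Mat a b
D a b t = V.tabulate (λ (i : Fin a) → V.tabulate (λ (j : Fin b) →
            t (Data.Fin.toℕ i ℕ.+ Data.Fin.toℕ j)))

xorV : {n : ℕ} → Vec Bool n → Vec Bool n → Vec Bool n
xorV = V.zipWith _xor_

sumRows : {a b : ℕ} → Vec Bool a → Mat a b → Vec Bool b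
sumRows []       []       = V.replicate _ false
sumRows (x ∷ xs) (r ∷ rs) = if x then xorV r (sumRows xs rs) else sumRows xs rs

isZeroV : {n : ℕ} → Vec Bool n → Bool
isZeroV v = all not (V.toList v)

subsetB : {a : ℕ} → Vec Bool a → Vec Bool a → Bool
subsetB T S = all (λ b → b) (V.toList (V.zipWith (λ x y → not x ∨ y) T S))

nonemptyB : {a : ℕ} → Vec Bool a → Bool
nonemptyB T = any (λ b → b) (V.toList T)

cardB : {a : ℕ} → Vec Bool a → ℕ
cardB T = countB (λ b → b) (V.toList T)

indepRows : {a b : ℕ} → Mat a b → Vec Bool a → Bool
indepRows {a} M S =
  all (λ T → not (subsetB T S ∧ nonemptyB T) ∨ not (isZeroV (sumRows T M))) (allVec a)

rank : {a b : ℕ} → Mat a b → ℕ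
rank {a} M = L.foldr _⊔_ 0 (L.map cardB (filter (T? ∘ indepRows M) (allVec a)))

Γ : (i a b : ℕ) → ℕ
Γ i a b = countB (λ α → rank (D a b (ext α)) ≡ᵇ i) (allVec (a ℕ.+ b ℕ.∸ 1))

-- Haar integral over ℙ of a function depending only on α_1,…,α_N
-- (cylinder function of depth N): the average over 𝔽₂^N.

∫ℙ[_]_ : (N : ℕ) → (ℙ → ℤ) → ℚ
∫ℙ[ N ] f = sumℤ (L.map (f ∘ ext) (allVec N)) / (2 ℕ.^ N)
  where instance _ = m^n≢0 2 N

sumℚ : List ℚ → ℚ
sumℚ = L.foldr ℚ._+_ ℚ.0ℚ

rhs : (s k q : ℕ) → ℚ
rhs s k q = sumℚ (L.map term (upTo (suc s)))
  where
  term : ℕ → ℚ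
  term i = (+ (2 ℕ.^ ((q ℕ.∸ 1) ℕ.* (k ℕ.+ s) ℕ.+ 1) ℕ.* Γ i s k)) / (2 ℕ.^ (q ℕ.* i))
    where instance _ = m^n≢0 2 (q ℕ.* i)

sumProds : {q k s : ℕ} → Vec (Vec Bool k × Vec Bool s) q → Poly
sumProds []             = []
sumProds ((Y , Z) ∷ ps) = addP (mulP (toPoly Y) (toPoly Z)) (sumProds ps)

R : (s k q : ℕ) → ℕ
R s k q = countB (isZeroP ∘ sumProds)
  (allVecOf (L.cartesianProduct (allVec k) (allVec s)) q)

module Submission where

-- The T^{-1}-coefficient of t·Y·Z is the 𝔽₂-pairing of Y with the row combination Zᵀ·D_{s×k}(t)
-- of the Hankel matrix, so summing the character over Y gives h(t) = 2^k · #{Z : Zᵀ·D(t) = 0}, and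
-- rank–nullity over 𝔽₂ turns this kernel size into 2^{s - r(D(t))}. The rank is the largest size of
-- an independent set of rows; rank–nullity 2^r · #ker = 2^s is proved by adding one row at a time,
-- the upper bound coming from the exchange lemma.
-- Since h depends only on α_1, …, α_{s+k-1}, its q-th moment is an average over 𝔽₂^{s+k-1}, which
-- grouped by rank is the Γ-sum. Expanding h^q instead as a sum over tuples (Y_1, Z_1, …, Y_q, Z_q)
-- and integrating over t first, orthogonality of E kills every tuple with Y_1Z_1 + ⋯ + Y_qZ_q ≠ 0,
-- which leaves R.

open import Algebra.Bundles using (AbelianGroup; CommutativeRing; CommutativeSemigroup)
open import Algebra.Core using (Op₂)
open import Algebra.Structures using (IsCommutativeSemiring; IsAbelianGroup)
open import Data.Bool using (Bool; true; false; _∧_; _∨_; _xor_; not; if_then_else_)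
open import Data.Bool.ListAction using (all; any)
open import Data.Bool.Properties
  using (T?; T-≡; ∧-zeroʳ; ∧-identityʳ; ∧-conicalˡ; ∧-conicalʳ; ∧-distribˡ-xor; xor-∧-commutativeRing;
         xor-same; xor-assoc; xor-comm; xor-identityˡ; xor-identityʳ)
open import Data.Fin using (Fin; zero; suc; toℕ)
open import Data.Fin.Properties using (toℕ<n)
open import Data.Fin.Subset using (Subset; ⁅_⁆)
open import Data.List using (List; []; _∷_; _++_; length; map; upTo; foldr; filter; concatMap; cartesianProduct)
open import Data.List.Membership.Propositional using (_∈_; find; lose)
open import Data.List.Membership.Propositional.Properties
  using (∈-++⁺ˡ; ∈-++⁺ʳ; ∈-map⁺; ∈-filter⁺; ∈-filter⁻; ∈-upTo⁻)
open import Data.List.Properties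
  using (++-identityʳ; map-id; length-map; map-applyUpTo; foldr-preservesᵇ; foldr-preservesᵒ)
open import Data.List.Relation.Unary.All as All using (All)
open import Data.List.Relation.Unary.All.Properties using (all⁺; all⁻; map⁺)
open import Data.List.Relation.Unary.Any using (here; there)
open import Data.List.Relation.Unary.Any.Properties using (any⁺; any⁻)
open import Data.Nat using (ℕ; zero; suc)
import Data.Nat.Properties as NP
open import Data.Product using (∃; _×_; _,_; proj₂)
open import Data.Sum using (_⊎_; inj₁; inj₂; [_,_])
open import Data.Vec as V using (Vec; []; _∷_; lookup; _[_]≔_)
open import Data.Vec.Properties
  using (length-toList; []≔-lookup; tabulate-cong; zipWith-assoc; zipWith-comm; zipWith-identityˡ; zipWith-identityʳ)
open import Function using (_∘_; id; const)
open import Function.Bundles using (Equivalence)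
open import Level using (0ℓ)
open import Relation.Binary.PropositionalEquality
  using (_≡_; refl; sym; trans; cong; cong₂; subst; subst₂; module ≡-Reasoning)
open import Relation.Binary.PropositionalEquality.Algebra using (isMagma)
open import Relation.Nullary using (contradiction)

open import Defs

module FiniteSum {A : Set} {_+_ _*_ : Op₂ A} {0# 1# : A}
                 (isCommutativeSemiring : IsCommutativeSemiring _≡_ _+_ _*_ 0# 1#) where

  open IsCommutativeSemiring isCommutativeSemiring
    using (+-assoc; +-comm; +-identityˡ; *-comm; distribˡ; zeroʳ; +-isCommutativeSemigroup)
  private
    +-commutativeSemigroup : CommutativeSemigroup 0ℓ 0ℓ
    +-commutativeSemigroup = record { isCommutativeSemigroup = +-isCommutativeSemigroup }

  open import Algebra.Properties.CommutativeSemigroup +-commutativeSemigroup using (interchange)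
  open ≡-Reasoning

  sum : List A → A
  sum = foldr _+_ 0#

  ∑ : {X : Set} → (X → A) → List X → A
  ∑ f xs = sum (map f xs)

  private variable X Y : Set

  ∑-cong : {f g : X → A} → (∀ x → f x ≡ g x) → (xs : List X) → ∑ f xs ≡ ∑ g xs
  ∑-cong f≗g []       = refl
  ∑-cong f≗g (x ∷ xs) = cong₂ _+_ (f≗g x) (∑-cong f≗g xs)

  ∑-++ : (f : X → A) (xs ys : List X) → ∑ f (xs ++ ys) ≡ ∑ f xs + ∑ f ys
  ∑-++ f []       ys = sym (+-identityˡ _)
  ∑-++ f (x ∷ xs) ys = trans (cong (f x +_) (∑-++ f xs ys)) (sym (+-assoc (f x) _ _))

  ∑-map : (f : Y → A) (g : X → Y) (xs : List X) → ∑ f (map g xs) ≡ ∑ (f ∘ g) xs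
  ∑-map f g []       = refl
  ∑-map f g (x ∷ xs) = cong (f (g x) +_) (∑-map f g xs)

  ∑-zero : (xs : List X) → ∑ (λ _ → 0#) xs ≡ 0#
  ∑-zero []       = refl
  ∑-zero (x ∷ xs) = trans (+-identityˡ _) (∑-zero xs)

  ∑-distrib-+ : (f g : X → A) (xs : List X) → ∑ (λ x → f x + g x) xs ≡ ∑ f xs + ∑ g xs
  ∑-distrib-+ f g []       = sym (+-identityˡ 0#)
  ∑-distrib-+ f g (x ∷ xs) = trans (cong ((f x + g x) +_) (∑-distrib-+ f g xs)) (interchange _ _ _ _)

  ∑-*ˡ : (c : A) (f : X → A) (xs : List X) → ∑ (λ x → c * f x) xs ≡ c * ∑ f xs
  ∑-*ˡ c f []       = sym (zeroʳ c)
  ∑-*ˡ c f (x ∷ xs) = trans (cong ((c * f x) +_) (∑-*ˡ c f xs)) (sym (distribˡ c (f x) _))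

  ∑-*ʳ : (c : A) (f : X → A) (xs : List X) → ∑ (λ x → f x * c) xs ≡ ∑ f xs * c
  ∑-*ʳ c f xs = begin
    ∑ (λ x → f x * c) xs   ≡⟨ ∑-cong (λ x → *-comm (f x) c) xs ⟩
    ∑ (λ x → c * f x) xs   ≡⟨ ∑-*ˡ c f xs ⟩
    c * ∑ f xs             ≡⟨ *-comm c (∑ f xs) ⟩
    ∑ f xs * c             ∎

  ∑-comm : (f : X → Y → A) (xs : List X) (ys : List Y) →
           ∑ (λ x → ∑ (f x) ys) xs ≡ ∑ (λ y → ∑ (λ x → f x y) xs) ys
  ∑-comm f []       ys = sym (∑-zero ys)
  ∑-comm f (x ∷ xs) ys =
    trans (cong (∑ (f x) ys +_) (∑-comm f xs ys)) (sym (∑-distrib-+ (f x) _ ys))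

  ∑-concatMap : (f : Y → A) (g : X → List Y) (xs : List X) →
                ∑ f (concatMap g xs) ≡ ∑ (λ x → ∑ f (g x)) xs
  ∑-concatMap f g []       = refl
  ∑-concatMap f g (x ∷ xs) =
    trans (∑-++ f (g x) (concatMap g xs)) (cong (∑ f (g x) +_) (∑-concatMap f g xs))

  ∑-cartesianProduct : (f : X × Y → A) (xs : List X) (ys : List Y) →
                       ∑ f (cartesianProduct xs ys) ≡ ∑ (λ x → ∑ (λ y → f (x , y)) ys) xs
  ∑-cartesianProduct f []       ys = refl
  ∑-cartesianProduct f (x ∷ xs) ys =
    trans (∑-++ f (map (x ,_) ys) _) (cong₂ _+_ (∑-map f (x ,_) ys) (∑-cartesianProduct f xs ys))

  sum-concatMap : (g : X → List A) (xs : List X) → sum (concatMap g xs) ≡ ∑ (sum ∘ g) xs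
  sum-concatMap g xs = begin
    sum (concatMap g xs)           ≡⟨ cong sum (map-id (concatMap g xs)) ⟨
    ∑ id (concatMap g xs)          ≡⟨ ∑-concatMap id g xs ⟩
    ∑ (λ x → ∑ id (g x)) xs        ≡⟨ ∑-cong (λ x → cong sum (map-id (g x))) xs ⟩
    ∑ (sum ∘ g) xs                 ∎

  ∑-allVec-suc : {n : ℕ} (f : Vec Bool (suc n) → A) →
                 ∑ f (allVec (suc n)) ≡ ∑ (f ∘ (false ∷_)) (allVec n) + ∑ (f ∘ (true ∷_)) (allVec n)
  ∑-allVec-suc {n} f = begin
    ∑ f (map (false ∷_) (allVec n) ++ (map (true ∷_) (allVec n) ++ []))
      ≡⟨ cong (λ l → ∑ f (map (false ∷_) (allVec n) ++ l)) (++-identityʳ _) ⟩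
    ∑ f (map (false ∷_) (allVec n) ++ map (true ∷_) (allVec n))
      ≡⟨ ∑-++ f (map (false ∷_) (allVec n)) _ ⟩
    ∑ f (map (false ∷_) (allVec n)) + ∑ f (map (true ∷_) (allVec n))
      ≡⟨ cong₂ _+_ (∑-map f _ (allVec n)) (∑-map f _ (allVec n)) ⟩
    ∑ (f ∘ (false ∷_)) (allVec n) + ∑ (f ∘ (true ∷_)) (allVec n) ∎

  ∑-allVec-xorV : {n : ℕ} (f : Vec Bool n → A) (c : Vec Bool n) →
                  ∑ (f ∘ xorV c) (allVec n) ≡ ∑ f (allVec n)
  ∑-allVec-xorV f []          = refl
  ∑-allVec-xorV f (false ∷ c) = begin
    ∑ (f ∘ xorV (false ∷ c)) (allVec (suc _))
      ≡⟨ ∑-allVec-suc (f ∘ xorV (false ∷ c)) ⟩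
    ∑ (f ∘ (false ∷_) ∘ xorV c) (allVec _) + ∑ (f ∘ (true ∷_) ∘ xorV c) (allVec _)
      ≡⟨ cong₂ _+_ (∑-allVec-xorV (f ∘ (false ∷_)) c) (∑-allVec-xorV (f ∘ (true ∷_)) c) ⟩
    ∑ (f ∘ (false ∷_)) (allVec _) + ∑ (f ∘ (true ∷_)) (allVec _)
      ≡⟨ ∑-allVec-suc f ⟨
    ∑ f (allVec (suc _)) ∎
  ∑-allVec-xorV f (true ∷ c) = begin
    ∑ (f ∘ xorV (true ∷ c)) (allVec (suc _))
      ≡⟨ ∑-allVec-suc (f ∘ xorV (true ∷ c)) ⟩
    ∑ (f ∘ (true ∷_) ∘ xorV c) (allVec _) + ∑ (f ∘ (false ∷_) ∘ xorV c) (allVec _)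
      ≡⟨ cong₂ _+_ (∑-allVec-xorV (f ∘ (true ∷_)) c) (∑-allVec-xorV (f ∘ (false ∷_)) c) ⟩
    ∑ (f ∘ (true ∷_)) (allVec _) + ∑ (f ∘ (false ∷_)) (allVec _)
      ≡⟨ +-comm _ _ ⟩
    ∑ (f ∘ (false ∷_)) (allVec _) + ∑ (f ∘ (true ∷_)) (allVec _)
      ≡⟨ ∑-allVec-suc f ⟨
    ∑ f (allVec (suc _)) ∎

open import Data.Nat using (_+_; _*_; _^_; _∸_; _≤_; _<_; _≡ᵇ_; z≤n; s≤s; NonZero)
open import Data.Integer as ℤ using (ℤ)
import Data.Integer.Properties as ZP

2^suc≡2^+2^ : ∀ n → 2 ^ suc n ≡ 2 ^ n + 2 ^ n
2^suc≡2^+2^ n = cong (2 ^ n +_) (NP.+-identityʳ (2 ^ n))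

2^suc*≡ : ∀ n i → 2 ^ suc n * i ≡ 2 ^ n * i + 2 ^ n * i
2^suc*≡ n i = trans (cong (_* i) (2^suc≡2^+2^ n)) (NP.*-distribʳ-+ i (2 ^ n) (2 ^ n))

*-double-≤ : ∀ x y m → x * y ≤ 2 ^ m → x * (y + y) ≤ 2 ^ suc m
*-double-≤ x y m xy≤2^m = begin
  x * (y + y)     ≡⟨ NP.*-distribˡ-+ x y y ⟩
  x * y + x * y   ≤⟨ NP.+-mono-≤ xy≤2^m xy≤2^m ⟩
  2 ^ m + 2 ^ m   ≡⟨ 2^suc≡2^+2^ m ⟨
  2 ^ suc m       ∎
  where open NP.≤-Reasoning

2^-reflects-≤ : ∀ m n → 2 ^ m ≤ 2 ^ n → m ≤ n
2^-reflects-≤ m n 2^m≤2^n = NP.≮⇒≥ (λ n<m → NP.<⇒≱ (NP.^-monoʳ-< 2 (s≤s (s≤s z≤n)) n<m) 2^m≤2^n)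

module Σℕ = FiniteSum NP.+-*-isCommutativeSemiring
module Σℤ = FiniteSum ZP.+-*-isCommutativeSemiring

indicator : Bool → ℕ
indicator b = if b then 1 else 0

countB≡∑indicator : {X : Set} (p : X → Bool) (xs : List X) → countB p xs ≡ Σℕ.∑ (indicator ∘ p) xs
countB≡∑indicator p []       = refl
countB≡∑indicator p (x ∷ xs) with p x
... | true  = cong suc (countB≡∑indicator p xs)
... | false = countB≡∑indicator p xs

∑-allVec-const : (n c : ℕ) → Σℕ.∑ (λ (_ : Vec Bool n) → c) (allVec n) ≡ 2 ^ n * c
∑-allVec-const zero    c = refl
∑-allVec-const (suc n) c = begin
  Σℕ.∑ (λ _ → c) (allVec (suc n))
    ≡⟨ Σℕ.∑-allVec-suc {n} (λ _ → c) ⟩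
  Σℕ.∑ (λ _ → c) (allVec n) + Σℕ.∑ (λ _ → c) (allVec n)
    ≡⟨ cong₂ _+_ (∑-allVec-const n c) (∑-allVec-const n c) ⟩
  2 ^ n * c + 2 ^ n * c
    ≡⟨ 2^suc*≡ n c ⟨
  2 ^ suc n * c ∎
  where open ≡-Reasoning

∈-allVec : {n : ℕ} (v : Vec Bool n) → v ∈ allVec n
∈-allVec []          = here refl
∈-allVec (false ∷ v) = ∈-++⁺ˡ (∈-map⁺ (false ∷_) (∈-allVec v))
∈-allVec (true ∷ v)  = ∈-++⁺ʳ (map (false ∷_) (allVec _)) (∈-++⁺ˡ (∈-map⁺ (true ∷_) (∈-allVec v)))

module _ {n : ℕ} (p : Vec Bool n → Bool) where

  all-allVec⁻ : all p (allVec n) ≡ true → ∀ v → p v ≡ true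
  all-allVec⁻ h v = Equivalence.to T-≡ (All.lookup (all⁺ p (allVec n) (Equivalence.from T-≡ h)) (∈-allVec v))

  all-allVec⁺ : (∀ v → p v ≡ true) → all p (allVec n) ≡ true
  all-allVec⁺ h = Equivalence.to T-≡ (all⁻ p {allVec n} (All.tabulate (λ {v} _ → Equivalence.from T-≡ (h v))))

  any-allVec⁻ : any p (allVec n) ≡ true → ∃ λ v → p v ≡ true
  any-allVec⁻ h with v , _ , pv ← find (any⁻ p (allVec n) (Equivalence.from T-≡ h)) = v , Equivalence.to T-≡ pv

  any-allVec⁺ : (v : Vec Bool n) → p v ≡ true → any p (allVec n) ≡ true
  any-allVec⁺ v pv = Equivalence.to T-≡ (any⁺ p (lose (∈-allVec v) (Equivalence.from T-≡ pv)))

∑-indicator-dichotomy : {X : Set} (p : X → Bool) (xs : List X) →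
  (Σℕ.∑ (indicator ∘ p) xs ≡ 0 × (∀ {x} → x ∈ xs → p x ≡ false)) ⊎ (∃ λ x → p x ≡ true)
∑-indicator-dichotomy p []       = inj₁ (refl , λ ())
∑-indicator-dichotomy p (x ∷ xs) with p x in px
... | true  = inj₂ (x , px)
... | false with ∑-indicator-dichotomy p xs
...   | inj₂ witness         = inj₂ witness
...   | inj₁ (sum≡0 , none) = inj₁ (sum≡0 , λ { (here refl) → px ; (there x∈xs) → none x∈xs })

zeros : (n : ℕ) → Vec Bool n
zeros n = V.replicate n false

xorV-self : {n : ℕ} (u : Vec Bool n) → xorV u u ≡ zeros n
xorV-self []      = refl
xorV-self (a ∷ u) = cong₂ _∷_ (xor-same a) (xorV-self u)

xorV-isAbelianGroup : (n : ℕ) → IsAbelianGroup _≡_ (xorV {n}) (zeros n) id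
xorV-isAbelianGroup n = record
  { isGroup = record
    { isMonoid = record
      { isSemigroup = record { isMagma = isMagma xorV ; assoc = zipWith-assoc xor-assoc }
      ; identity    = zipWith-identityˡ xor-identityˡ , zipWith-identityʳ xor-identityʳ
      }
    ; inverse = xorV-self , xorV-self
    ; ⁻¹-cong = cong id
    }
  ; comm = zipWith-comm xor-comm
  }

𝔽₂^ : ℕ → AbelianGroup 0ℓ 0ℓ
𝔽₂^ n = record { isAbelianGroup = xorV-isAbelianGroup n }

isZeroV-sound : {n : ℕ} (v : Vec Bool n) → isZeroV v ≡ true → v ≡ zeros n
isZeroV-sound []          _ = refl
isZeroV-sound (false ∷ v) h = cong (false ∷_) (isZeroV-sound v h)

isZeroV-zeros : (n : ℕ) → isZeroV (zeros n) ≡ true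
isZeroV-zeros zero    = refl
isZeroV-zeros (suc n) = isZeroV-zeros n

module _ {n : ℕ} where

  open AbelianGroup (𝔽₂^ n) public using ()
    renaming (assoc to xorV-assoc; comm to xorV-comm; identityˡ to xorV-identityˡ; identityʳ to xorV-identityʳ)
  open import Algebra.Properties.CommutativeSemigroup (AbelianGroup.commutativeSemigroup (𝔽₂^ n)) public using ()
    renaming (interchange to xorV-interchange; x∙yz≈y∙xz to xorV-leftComm)
  open import Algebra.Properties.Group (AbelianGroup.group (𝔽₂^ n)) using (inverseˡ-unique)

  isZeroV-xorV⇒≡ : (u v : Vec Bool n) → isZeroV (xorV u v) ≡ true → u ≡ v
  isZeroV-xorV⇒≡ u v h = inverseˡ-unique u v (isZeroV-sound _ h)

isZeroV-xorV-self : {n : ℕ} (u : Vec Bool n) → isZeroV (xorV u u) ≡ true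
isZeroV-xorV-self {n} u = trans (cong isZeroV (xorV-self u)) (isZeroV-zeros n)

sumRows-zeros : {a b : ℕ} (M : Mat a b) → sumRows (zeros a) M ≡ zeros b
sumRows-zeros []      = refl
sumRows-zeros (r ∷ M) = sumRows-zeros M

sumRows-xorV : {a b : ℕ} (T₁ T₂ : Vec Bool a) (M : Mat a b) →
               sumRows (xorV T₁ T₂) M ≡ xorV (sumRows T₁ M) (sumRows T₂ M)
sumRows-xorV []           []           []      = sym (xorV-self _)
sumRows-xorV (false ∷ T₁) (false ∷ T₂) (r ∷ M) = sumRows-xorV T₁ T₂ M
sumRows-xorV (true ∷ T₁)  (false ∷ T₂) (r ∷ M) =
  trans (cong (xorV r) (sumRows-xorV T₁ T₂ M)) (sym (xorV-assoc r _ _))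
sumRows-xorV (false ∷ T₁) (true ∷ T₂)  (r ∷ M) =
  trans (cong (xorV r) (sumRows-xorV T₁ T₂ M)) (xorV-leftComm r _ _)
sumRows-xorV (true ∷ T₁)  (true ∷ T₂)  (r ∷ M) = begin
  sumRows (xorV T₁ T₂) M               ≡⟨ sumRows-xorV T₁ T₂ M ⟩
  xorV s₁ s₂                           ≡⟨ xorV-identityˡ _ ⟨
  xorV (zeros _) (xorV s₁ s₂)          ≡⟨ cong (λ z → xorV z (xorV s₁ s₂)) (xorV-self r) ⟨
  xorV (xorV r r) (xorV s₁ s₂)         ≡⟨ xorV-interchange r r s₁ s₂ ⟩
  xorV (xorV r s₁) (xorV r s₂)         ∎
  where
  open ≡-Reasoning
  s₁ = sumRows T₁ M
  s₂ = sumRows T₂ M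

fibre : {a b : ℕ} → Mat a b → Vec Bool b → ℕ
fibre {a} M v = Σℕ.∑ (λ Z → indicator (isZeroV (xorV (sumRows Z M) v))) (allVec a)

kernelSize : {a b : ℕ} → Mat a b → ℕ
kernelSize {b = b} M = fibre M (zeros b)

fibre-∷ : {a b : ℕ} (r : Vec Bool b) (M : Mat a b) (v : Vec Bool b) →
          fibre (r ∷ M) v ≡ fibre M v + fibre M (xorV r v)
fibre-∷ {a} r M v =
  trans (Σℕ.∑-allVec-suc {a} (λ Z → indicator (isZeroV (xorV (sumRows Z (r ∷ M)) v))))
        (cong (fibre M v +_) (Σℕ.∑-cong (λ Z → cong (indicator ∘ isZeroV) (xorV-rearrange (sumRows Z M))) (allVec a)))
  where
  xorV-rearrange : ∀ s → xorV (xorV r s) v ≡ xorV s (xorV r v)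
  xorV-rearrange s = trans (cong (λ z → xorV z v) (xorV-comm r s)) (xorV-assoc s r v)

fibre-coset : {a b : ℕ} (M : Mat a b) (Z₀ : Vec Bool a) (v w : Vec Bool b) →
              sumRows Z₀ M ≡ xorV v w → fibre M v ≡ fibre M w
fibre-coset {a} M Z₀ v w Z₀M≡v+w =
  trans (Σℕ.∑-cong (λ Z → cong (indicator ∘ isZeroV) (shift Z)) (allVec a))
        (Σℕ.∑-allVec-xorV (λ Z → indicator (isZeroV (xorV (sumRows Z M) w))) Z₀)
  where
  shift : ∀ Z → xorV (sumRows Z M) v ≡ xorV (sumRows (xorV Z₀ Z) M) w
  shift Z = sym (begin
    xorV (sumRows (xorV Z₀ Z) M) w      ≡⟨ cong (λ z → xorV z w) (sumRows-xorV Z₀ Z M) ⟩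
    xorV (xorV (sumRows Z₀ M) s) w      ≡⟨ cong (λ z → xorV (xorV z s) w) Z₀M≡v+w ⟩
    xorV (xorV (xorV v w) s) w          ≡⟨ cong (λ z → xorV z w) (xorV-comm (xorV v w) s) ⟩
    xorV (xorV s (xorV v w)) w          ≡⟨ xorV-assoc s (xorV v w) w ⟩
    xorV s (xorV (xorV v w) w)          ≡⟨ cong (xorV s) (xorV-assoc v w w) ⟩
    xorV s (xorV v (xorV w w))          ≡⟨ cong (λ z → xorV s (xorV v z)) (xorV-self w) ⟩
    xorV s (xorV v (zeros _))           ≡⟨ cong (xorV s) (xorV-identityʳ v) ⟩
    xorV s v                            ∎)
    where
    open ≡-Reasoning
    s = sumRows Z M

fibre-dichotomy : {a b : ℕ} (M : Mat a b) (v : Vec Bool b) →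
  (fibre M v ≡ 0 × (∀ Z → isZeroV (xorV (sumRows Z M) v) ≡ false))
  ⊎ (∃ λ Z → sumRows Z M ≡ v)
fibre-dichotomy {a} M v with ∑-indicator-dichotomy (λ Z → isZeroV (xorV (sumRows Z M) v)) (allVec a)
... | inj₁ (fibre≡0 , none) = inj₁ (fibre≡0 , λ Z → none (∈-allVec Z))
... | inj₂ (Z , ZM+v≡0)     = inj₂ (Z , isZeroV-xorV⇒≡ _ _ ZM+v≡0)

kernelSize-[] : {b : ℕ} → kernelSize ([] {A = Vec Bool b}) ≡ 1
kernelSize-[] {b} = cong (λ z → indicator z + 0) (isZeroV-xorV-self (zeros b))

kernelSize-∷-free : {a b : ℕ} (r : Vec Bool b) (M : Mat a b) →
                    fibre M r ≡ 0 → kernelSize (r ∷ M) ≡ kernelSize M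
kernelSize-∷-free r M fibre≡0 = begin
  kernelSize (r ∷ M)                   ≡⟨ fibre-∷ r M _ ⟩
  kernelSize M + fibre M (xorV r _)    ≡⟨ cong (λ v → kernelSize M + fibre M v) (xorV-identityʳ r) ⟩
  kernelSize M + fibre M r             ≡⟨ cong (kernelSize M +_) fibre≡0 ⟩
  kernelSize M + 0                     ≡⟨ NP.+-identityʳ _ ⟩
  kernelSize M                         ∎
  where open ≡-Reasoning

kernelSize-∷-spanned : {a b : ℕ} (r : Vec Bool b) (M : Mat a b) (Z₀ : Vec Bool a) →
                       sumRows Z₀ M ≡ r → kernelSize (r ∷ M) ≡ kernelSize M + kernelSize M
kernelSize-∷-spanned r M Z₀ Z₀M≡r = begin
  kernelSize (r ∷ M)                   ≡⟨ fibre-∷ r M _ ⟩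
  kernelSize M + fibre M (xorV r _)    ≡⟨ cong (λ v → kernelSize M + fibre M v) (xorV-identityʳ r) ⟩
  kernelSize M + fibre M r
    ≡⟨ cong (kernelSize M +_) (fibre-coset M Z₀ r _ (trans Z₀M≡r (sym (xorV-identityʳ r)))) ⟩
  kernelSize M + kernelSize M          ∎
  where open ≡-Reasoning

-- Independent rows, exchange and rank–nullity

Independent : {a b : ℕ} → Mat a b → Subset a → Set
Independent {a} M S =
  ∀ (T : Subset a) → subsetB T S ≡ true → nonemptyB T ≡ true → isZeroV (sumRows T M) ≡ false

module _ {a b : ℕ} (M : Mat a b) (S : Subset a) where

  indepRows⇒Independent : indepRows M S ≡ true → Independent M S
  indepRows⇒Independent h T T⊆S T≢∅ = isZero≡false (all-allVec⁻ _ h T)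
    where
    isZero≡false : not (subsetB T S ∧ nonemptyB T) ∨ not (isZeroV (sumRows T M)) ≡ true →
                   isZeroV (sumRows T M) ≡ false
    isZero≡false e rewrite T⊆S | T≢∅ with isZeroV (sumRows T M)
    ... | false = refl

  Independent⇒indepRows : Independent M S → indepRows M S ≡ true
  Independent⇒indepRows ind = all-allVec⁺ _ clause
    where
    clause : ∀ T → not (subsetB T S ∧ nonemptyB T) ∨ not (isZeroV (sumRows T M)) ≡ true
    clause T with subsetB T S in T⊆S | nonemptyB T in T≢∅
    ... | false | _    = refl
    ... | true  | false = refl
    ... | true  | true rewrite ind T T⊆S T≢∅ = refl

module _ {a b : ℕ} (r : Vec Bool b) (M : Mat a b) (S : Subset a) where

  Independent-∷⁻ : ∀ {c} → Independent (r ∷ M) (c ∷ S) → Independent M S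
  Independent-∷⁻ ind T = ind (false ∷ T)

  Independent-∷-false : Independent M S → Independent (r ∷ M) (false ∷ S)
  Independent-∷-false ind (false ∷ T) = ind T

  Independent-∷-true : Independent M S → (∀ Z → isZeroV (xorV (sumRows Z M) r) ≡ false) →
                       Independent (r ∷ M) (true ∷ S)
  Independent-∷-true ind r∉rowSpace (false ∷ T) T⊆S T≢∅ = ind T T⊆S T≢∅
  Independent-∷-true ind r∉rowSpace (true ∷ T)  _   _   =
    trans (cong isZeroV (xorV-comm r (sumRows T M))) (r∉rowSpace T)

  Independent-head : Independent (r ∷ M) (true ∷ S) →
                     ∀ T → subsetB T S ≡ true → isZeroV (xorV r (sumRows T M)) ≡ false
  Independent-head ind T T⊆S = ind (true ∷ T) T⊆S refl

Independent-[] : {b : ℕ} → Independent ([] {A = Vec Bool b}) []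
Independent-[] [] _ ()

∃-Independent-rankNullity : {a b : ℕ} (M : Mat a b) →
  ∃ λ S → Independent M S × 2 ^ cardB S * kernelSize M ≡ 2 ^ a
∃-Independent-rankNullity {b = b} [] = [] , Independent-[] , trans (NP.+-identityʳ _) (kernelSize-[] {b})
∃-Independent-rankNullity {suc a} (r ∷ M) with ∃-Independent-rankNullity M | fibre-dichotomy M r
... | S , ind , 2^∣S∣κ≡2^a | inj₁ (fibre≡0 , r∉rowSpace) =
  true ∷ S , Independent-∷-true r M S ind r∉rowSpace , (begin
    2 ^ suc (cardB S) * kernelSize (r ∷ M) ≡⟨ cong (2 ^ suc (cardB S) *_) (kernelSize-∷-free r M fibre≡0) ⟩
    2 * 2 ^ cardB S * kernelSize M         ≡⟨ NP.*-assoc 2 (2 ^ cardB S) (kernelSize M) ⟩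
    2 * (2 ^ cardB S * kernelSize M)       ≡⟨ cong (2 *_) 2^∣S∣κ≡2^a ⟩
    2 ^ suc a                              ∎)
  where open ≡-Reasoning
... | S , ind , 2^∣S∣κ≡2^a | inj₂ (Z₀ , Z₀M≡r) =
  false ∷ S , Independent-∷-false r M S ind , (begin
    2 ^ cardB S * kernelSize (r ∷ M)       ≡⟨ cong (2 ^ cardB S *_) (kernelSize-∷-spanned r M Z₀ Z₀M≡r) ⟩
    2 ^ cardB S * (kernelSize M + kernelSize M)
      ≡⟨ NP.*-distribˡ-+ (2 ^ cardB S) (kernelSize M) (kernelSize M) ⟩
    2 ^ cardB S * kernelSize M + 2 ^ cardB S * kernelSize M
      ≡⟨ cong₂ _+_ 2^∣S∣κ≡2^a 2^∣S∣κ≡2^a ⟩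
    2 ^ a + 2 ^ a                          ≡⟨ 2^suc≡2^+2^ a ⟨
    2 ^ suc a                              ∎)
  where open ≡-Reasoning

sumRows-⁅⁆ : {a b : ℕ} (M : Mat a b) (j : Fin a) → sumRows ⁅ j ⁆ M ≡ lookup M j
sumRows-⁅⁆ (r ∷ M) zero    = trans (cong (xorV r) (sumRows-zeros M)) (xorV-identityʳ r)
sumRows-⁅⁆ (r ∷ M) (suc j) = sumRows-⁅⁆ M j

sumRows-[]≔false : {a b : ℕ} (T : Subset a) (M : Mat a b) (j : Fin a) → lookup T j ≡ true →
                   sumRows T M ≡ xorV (lookup M j) (sumRows (T [ j ]≔ false) M)
sumRows-[]≔false (true ∷ T)  (r ∷ M) zero    _  = refl
sumRows-[]≔false (false ∷ T) (r ∷ M) (suc j) Tj = sumRows-[]≔false T M j Tj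
sumRows-[]≔false (true ∷ T)  (r ∷ M) (suc j) Tj =
  trans (cong (xorV r) (sumRows-[]≔false T M j Tj)) (xorV-leftComm r _ _)

subsetB-zeros : {n : ℕ} (S : Subset n) → subsetB (zeros n) S ≡ true
subsetB-zeros []      = refl
subsetB-zeros (s ∷ S) = subsetB-zeros S

subsetB-⁅⁆ : {n : ℕ} (S : Subset n) (j : Fin n) → lookup S j ≡ true → subsetB ⁅ j ⁆ S ≡ true
subsetB-⁅⁆ (true ∷ S) zero    _  = subsetB-zeros S
subsetB-⁅⁆ (s ∷ S)    (suc j) Sj = subsetB-⁅⁆ S j Sj

subsetB-xorV : {n : ℕ} (T₁ T₂ S : Subset n) →
               subsetB T₁ S ≡ true → subsetB T₂ S ≡ true → subsetB (xorV T₁ T₂) S ≡ true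
subsetB-xorV []           []           []       _ _ = refl
subsetB-xorV (false ∷ T₁) (false ∷ T₂) (s ∷ S)  h₁ h₂ = subsetB-xorV T₁ T₂ S h₁ h₂
subsetB-xorV (true ∷ T₁)  (false ∷ T₂) (true ∷ S) h₁ h₂ = subsetB-xorV T₁ T₂ S h₁ h₂
subsetB-xorV (false ∷ T₁) (true ∷ T₂)  (true ∷ S) h₁ h₂ = subsetB-xorV T₁ T₂ S h₁ h₂
subsetB-xorV (true ∷ T₁)  (true ∷ T₂)  (true ∷ S) h₁ h₂ = subsetB-xorV T₁ T₂ S h₁ h₂

subsetB-[]≔ : {n : ℕ} (T S : Subset n) (j : Fin n) →
              subsetB T (S [ j ]≔ true) ≡ true → subsetB (T [ j ]≔ false) S ≡ true
subsetB-[]≔ (false ∷ T) (s ∷ S)    zero    h = h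
subsetB-[]≔ (true ∷ T)  (s ∷ S)    zero    h = h
subsetB-[]≔ (false ∷ T) (s ∷ S)    (suc j) h = subsetB-[]≔ T S j h
subsetB-[]≔ (true ∷ T)  (true ∷ S) (suc j) h = subsetB-[]≔ T S j h

cardB-[]≔true : {n : ℕ} (S : Subset n) (j : Fin n) → lookup S j ≡ false →
                cardB (S [ j ]≔ true) ≡ suc (cardB S)
cardB-[]≔true (false ∷ S) zero    _  = refl
cardB-[]≔true (false ∷ S) (suc j) Sj = cardB-[]≔true S j Sj
cardB-[]≔true (true ∷ S)  (suc j) Sj = cong suc (cardB-[]≔true S j Sj)

∃-row∉subspace : {a b : ℕ} (w : Vec Bool b → Bool) →
  (∀ u v → w u ≡ true → w v ≡ true → w (xorV u v) ≡ true) → w (zeros b) ≡ true →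
  (M : Mat a b) (Z : Subset a) → w (sumRows Z M) ≡ false → ∃ λ j → w (lookup M j) ≡ false
∃-row∉subspace w closed w0 []      []          w[ZM]≡false = contradiction (trans (sym w[ZM]≡false) w0) λ ()
∃-row∉subspace w closed w0 (r ∷ M) (false ∷ Z) w[ZM]≡false with j , e ← ∃-row∉subspace w closed w0 M Z w[ZM]≡false =
  suc j , e
∃-row∉subspace w closed w0 (r ∷ M) (true ∷ Z)  w[ZM]≡false with w r in wr | w (sumRows Z M) in wZM
... | false | _     = zero , wr
... | true  | true  = contradiction (trans (sym w[ZM]≡false) (closed r _ wr wZM)) λ ()
... | true  | false with j , e ← ∃-row∉subspace w closed w0 M Z wZM = suc j , e

inSpan : {a b : ℕ} → Mat a b → Subset a → Vec Bool b → Bool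
inSpan {a} M S v = any (λ T → subsetB T S ∧ isZeroV (xorV (sumRows T M) v)) (allVec a)

module _ {a b : ℕ} (M : Mat a b) (S : Subset a) where

  inSpan⁺ : (T : Subset a) → subsetB T S ≡ true → inSpan M S (sumRows T M) ≡ true
  inSpan⁺ T T⊆S = any-allVec⁺ _ T (subst (λ x → x ∧ _ ≡ true) (sym T⊆S) (isZeroV-xorV-self (sumRows T M)))

  inSpan⁻ : (v : Vec Bool b) → inSpan M S v ≡ true → ∃ λ T → subsetB T S ≡ true × sumRows T M ≡ v
  inSpan⁻ v h with T , e ← any-allVec⁻ _ h =
    T , ∧-conicalˡ _ _ e , isZeroV-xorV⇒≡ _ _ (∧-conicalʳ _ _ e)

  inSpan-xorV : (u v : Vec Bool b) → inSpan M S u ≡ true → inSpan M S v ≡ true → inSpan M S (xorV u v) ≡ true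
  inSpan-xorV u v u∈ v∈ with T₁ , T₁⊆S , T₁M≡u ← inSpan⁻ u u∈ | T₂ , T₂⊆S , T₂M≡v ← inSpan⁻ v v∈ =
    subst (λ w → inSpan M S w ≡ true) (trans (sumRows-xorV T₁ T₂ M) (cong₂ xorV T₁M≡u T₂M≡v))
      (inSpan⁺ (xorV T₁ T₂) (subsetB-xorV T₁ T₂ S T₁⊆S T₂⊆S))

  inSpan-zeros : inSpan M S (zeros b) ≡ true
  inSpan-zeros = subst (λ w → inSpan M S w ≡ true) (sumRows-zeros M) (inSpan⁺ (zeros a) (subsetB-zeros S))

  inSpan-row : (j : Fin a) → lookup S j ≡ true → inSpan M S (lookup M j) ≡ true
  inSpan-row j Sj = subst (λ w → inSpan M S w ≡ true) (sumRows-⁅⁆ M j) (inSpan⁺ ⁅ j ⁆ (subsetB-⁅⁆ S j Sj))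

  exchange : Independent M S → (Z₀ : Subset a) → inSpan M S (sumRows Z₀ M) ≡ false →
             ∃ λ S′ → Independent M S′ × cardB S′ ≡ suc (cardB S)
  exchange ind Z₀ Z₀M∉span
    with j , Mj∉span ← ∃-row∉subspace (inSpan M S) inSpan-xorV inSpan-zeros M Z₀ Z₀M∉span =
    S [ j ]≔ true , ind′ , cardB-[]≔true S j Sj≡false
    where
    Sj≡false : lookup S j ≡ false
    Sj≡false with lookup S j in Sj
    ... | false = refl
    ... | true  = contradiction (trans (sym Mj∉span) (inSpan-row j Sj)) λ ()

    ind′ : Independent M (S [ j ]≔ true)
    ind′ T T⊆S′ T≢∅ with lookup T j in Tj
    ... | false = subst (λ U → isZeroV (sumRows U M) ≡ false) T[j]≔false≡T
                    (ind (T [ j ]≔ false) (subsetB-[]≔ T S j T⊆S′)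
                         (subst (λ U → nonemptyB U ≡ true) (sym T[j]≔false≡T) T≢∅))
      where
      T[j]≔false≡T : T [ j ]≔ false ≡ T
      T[j]≔false≡T = trans (cong (T [ j ]≔_) (sym Tj)) ([]≔-lookup T j)
    ... | true with isZeroV (sumRows T M) in TM≡0
    ...   | false = refl
    ...   | true  = contradiction (trans (sym Mj∉span) Mj∈span) λ ()
      where
      Mj≡T′M : lookup M j ≡ sumRows (T [ j ]≔ false) M
      Mj≡T′M = isZeroV-xorV⇒≡ _ _ (subst (λ v → isZeroV v ≡ true) (sumRows-[]≔false T M j Tj) TM≡0)
      Mj∈span : inSpan M S (lookup M j) ≡ true
      Mj∈span = subst (λ w → inSpan M S w ≡ true) (sym Mj≡T′M)
                      (inSpan⁺ (T [ j ]≔ false) (subsetB-[]≔ T S j T⊆S′))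

Independent-∷-true⇒∉span : {a b : ℕ} (r : Vec Bool b) (M : Mat a b) (S : Subset a) →
                            Independent (r ∷ M) (true ∷ S) → inSpan M S r ≡ false
Independent-∷-true⇒∉span r M S ind with inSpan M S r in r∈span
... | false = refl
... | true with T , T⊆S , TM≡r ← inSpan⁻ M S r r∈span =
  contradiction (trans (sym (Independent-head r M S ind T T⊆S))
                       (subst (λ v → isZeroV (xorV r v) ≡ true) (sym TM≡r) (isZeroV-xorV-self r))) λ ()

Independent-bound : {a b : ℕ} (M : Mat a b) (S : Subset a) → Independent M S →
                    2 ^ cardB S * kernelSize M ≤ 2 ^ a
Independent-bound {b = b} [] [] _ = NP.≤-reflexive (trans (NP.+-identityʳ _) (kernelSize-[] {b}))
Independent-bound {suc a} (r ∷ M) (c ∷ S) ind with fibre-dichotomy M r | c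
... | inj₁ (fibre≡0 , _) | false = begin
  2 ^ cardB S * kernelSize (r ∷ M)   ≡⟨ cong (2 ^ cardB S *_) (kernelSize-∷-free r M fibre≡0) ⟩
  2 ^ cardB S * kernelSize M         ≤⟨ Independent-bound M S (Independent-∷⁻ r M S ind) ⟩
  2 ^ a                              ≤⟨ NP.m≤m+n (2 ^ a) _ ⟩
  2 ^ suc a                          ∎
  where open NP.≤-Reasoning
... | inj₁ (fibre≡0 , _) | true = begin
  2 ^ suc (cardB S) * kernelSize (r ∷ M) ≡⟨ cong (2 ^ suc (cardB S) *_) (kernelSize-∷-free r M fibre≡0) ⟩
  2 * 2 ^ cardB S * kernelSize M         ≡⟨ NP.*-assoc 2 (2 ^ cardB S) (kernelSize M) ⟩
  2 * (2 ^ cardB S * kernelSize M)       ≤⟨ NP.*-monoʳ-≤ 2 (Independent-bound M S (Independent-∷⁻ r M S ind)) ⟩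
  2 ^ suc a                              ∎
  where open NP.≤-Reasoning
... | inj₂ (Z₀ , Z₀M≡r) | false =
  subst (λ κ → 2 ^ cardB S * κ ≤ 2 ^ suc a) (sym (kernelSize-∷-spanned r M Z₀ Z₀M≡r))
        (*-double-≤ (2 ^ cardB S) (kernelSize M) a (Independent-bound M S (Independent-∷⁻ r M S ind)))
... | inj₂ (Z₀ , Z₀M≡r) | true
  with S′ , ind′ , ∣S′∣≡1+∣S∣ ← exchange M S (Independent-∷⁻ r M S ind) Z₀
                                   (subst (λ v → inSpan M S v ≡ false) (sym Z₀M≡r) (Independent-∷-true⇒∉span r M S ind)) =
  subst₂ (λ k κ → 2 ^ k * κ ≤ 2 ^ suc a) ∣S′∣≡1+∣S∣ (sym (kernelSize-∷-spanned r M Z₀ Z₀M≡r))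
         (*-double-≤ (2 ^ cardB S′) (kernelSize M) a (Independent-bound M S′ ind′))

cardB≤length : {n : ℕ} (S : Subset n) → cardB S ≤ n
cardB≤length []          = z≤n
cardB≤length (true ∷ S)  = s≤s (cardB≤length S)
cardB≤length (false ∷ S) = NP.m≤n⇒m≤1+n (cardB≤length S)

module _ {a b : ℕ} (M : Mat a b) where

  private
    independentSets : List (Subset a)
    independentSets = filter (T? ∘ indepRows M) (allVec a)

  rank≡cardB-basis : ∃ λ S → Independent M S × 2 ^ cardB S * kernelSize M ≡ 2 ^ a × rank M ≡ cardB S
  rank≡cardB-basis with S₀ , ind₀ , 2^∣S₀∣κ≡2^a ← ∃-Independent-rankNullity M =
    S₀ , ind₀ , 2^∣S₀∣κ≡2^a , NP.≤-antisym rank≤∣S₀∣ ∣S₀∣≤rank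
    where
    instance
      κ≢0 : NonZero (kernelSize M)
      κ≢0 = NP.m*n≢0⇒n≢0 (2 ^ cardB S₀) {{subst NonZero (sym 2^∣S₀∣κ≡2^a) (NP.m^n≢0 2 a)}}

    ∣S∣≤∣S₀∣ : ∀ {S} → S ∈ independentSets → cardB S ≤ cardB S₀
    ∣S∣≤∣S₀∣ {S} S∈ = 2^-reflects-≤ _ _ (NP.*-cancelʳ-≤ _ _ (kernelSize M) (begin
      2 ^ cardB S * kernelSize M   ≤⟨ Independent-bound M S S-independent ⟩
      2 ^ a                        ≡⟨ 2^∣S₀∣κ≡2^a ⟨
      2 ^ cardB S₀ * kernelSize M  ∎))
      where
      open NP.≤-Reasoning
      S-independent : Independent M S
      S-independent = indepRows⇒Independent M S
        (Equivalence.to T-≡ (proj₂ (∈-filter⁻ (T? ∘ indepRows M) {xs = allVec a} S∈)))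

    rank≤∣S₀∣ : rank M ≤ cardB S₀
    rank≤∣S₀∣ = foldr-preservesᵇ {P = _≤ cardB S₀} NP.⊔-lub z≤n (map⁺ (All.tabulate ∣S∣≤∣S₀∣))

    ∣S₀∣≤rank : cardB S₀ ≤ rank M
    ∣S₀∣≤rank = foldr-preservesᵒ {P = cardB S₀ ≤_}
      (λ x y → [ (λ ≤x → NP.≤-trans ≤x (NP.m≤m⊔n x y)) , (λ ≤y → NP.≤-trans ≤y (NP.m≤n⊔m x y)) ])
      0 _ (inj₂ (lose (∈-map⁺ cardB S₀∈) NP.≤-refl))
      where
      S₀∈ : S₀ ∈ independentSets
      S₀∈ = ∈-filter⁺ (T? ∘ indepRows M) (∈-allVec S₀)
                      (Equivalence.from T-≡ (Independent⇒indepRows M S₀ ind₀))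

  rank≤rows : rank M ≤ a
  rank≤rows with S , _ , _ , rank≡∣S∣ ← rank≡cardB-basis = subst (_≤ a) (sym rank≡∣S∣) (cardB≤length S)

  kernelSize≡2^[a∸rank] : kernelSize M ≡ 2 ^ (a ∸ rank M)
  kernelSize≡2^[a∸rank] with S , _ , 2^∣S∣κ≡2^a , rank≡∣S∣ ← rank≡cardB-basis =
    NP.*-cancelˡ-≡ _ _ (2 ^ rank M) {{NP.m^n≢0 2 (rank M)}} (begin
      2 ^ rank M * kernelSize M        ≡⟨ cong (λ k → 2 ^ k * kernelSize M) rank≡∣S∣ ⟩
      2 ^ cardB S * kernelSize M       ≡⟨ 2^∣S∣κ≡2^a ⟩
      2 ^ a                            ≡⟨ cong (2 ^_) (NP.m+[n∸m]≡n rank≤rows) ⟨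
      2 ^ (rank M + (a ∸ rank M))      ≡⟨ NP.^-distribˡ-+-* 2 (rank M) (a ∸ rank M) ⟩
      2 ^ rank M * 2 ^ (a ∸ rank M)    ∎)
    where open ≡-Reasoning

_∷ℙ_ : Bool → ℙ → ℙ
(b ∷ℙ t) zero    = b
(b ∷ℙ t) (suc i) = t i

DependsOnPrefix : ℕ → (ℙ → ℕ) → Set
DependsOnPrefix M G = ∀ t t′ → (∀ i → i < M → t i ≡ t′ i) → G t ≡ G t′

∑-allVec-prefix : (M : ℕ) (G : ℙ → ℕ) → DependsOnPrefix M G → (N : ℕ) → M ≤ N →
                  Σℕ.∑ (G ∘ ext) (allVec N) ≡ 2 ^ (N ∸ M) * Σℕ.∑ (G ∘ ext) (allVec M)
∑-allVec-prefix zero    G dep N       _         = begin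
  Σℕ.∑ (G ∘ ext) (allVec N)         ≡⟨ Σℕ.∑-cong (λ α → dep (ext α) (ext []) λ _ ()) (allVec N) ⟩
  Σℕ.∑ (λ _ → G (ext [])) (allVec N) ≡⟨ ∑-allVec-const N (G (ext [])) ⟩
  2 ^ N * G (ext [])                ≡⟨ cong (2 ^ N *_) (NP.+-identityʳ _) ⟨
  2 ^ N * (G (ext []) + 0)          ∎
  where open ≡-Reasoning
∑-allVec-prefix (suc M) G dep (suc N) (s≤s M≤N) = begin
  Σℕ.∑ (G ∘ ext) (allVec (suc N))
    ≡⟨ Σℕ.∑-allVec-suc {N} (G ∘ ext) ⟩
  Σℕ.∑ (λ α → G (ext (false ∷ α))) (allVec N) + Σℕ.∑ (λ α → G (ext (true ∷ α))) (allVec N)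
    ≡⟨ cong₂ _+_ (Σℕ.∑-cong (ext-∷ false) (allVec N)) (Σℕ.∑-cong (ext-∷ true) (allVec N)) ⟩
  Σℕ.∑ (G′ false ∘ ext) (allVec N) + Σℕ.∑ (G′ true ∘ ext) (allVec N)
    ≡⟨ cong₂ _+_ (∑-allVec-prefix M (G′ false) (dep′ false) N M≤N)
                 (∑-allVec-prefix M (G′ true) (dep′ true) N M≤N) ⟩
  c * Σℕ.∑ (G′ false ∘ ext) (allVec M) + c * Σℕ.∑ (G′ true ∘ ext) (allVec M)
    ≡⟨ NP.*-distribˡ-+ c _ _ ⟨
  c * (Σℕ.∑ (G′ false ∘ ext) (allVec M) + Σℕ.∑ (G′ true ∘ ext) (allVec M))
    ≡⟨ cong (c *_) (cong₂ _+_ (Σℕ.∑-cong (ext-∷ false) (allVec M)) (Σℕ.∑-cong (ext-∷ true) (allVec M))) ⟨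
  c * (Σℕ.∑ (λ α → G (ext (false ∷ α))) (allVec M) + Σℕ.∑ (λ α → G (ext (true ∷ α))) (allVec M))
    ≡⟨ cong (c *_) (Σℕ.∑-allVec-suc {M} (G ∘ ext)) ⟨
  c * Σℕ.∑ (G ∘ ext) (allVec (suc M)) ∎
  where
  open ≡-Reasoning
  c = 2 ^ (N ∸ M)
  G′ : Bool → ℙ → ℕ
  G′ b t = G (b ∷ℙ t)
  ext-∷ : ∀ b {n} (α : Vec Bool n) → G (ext (b ∷ α)) ≡ G′ b (ext α)
  ext-∷ b α = dep _ _ λ { zero _ → refl ; (suc i) _ → refl }
  dep′ : ∀ b → DependsOnPrefix M (G′ b)
  dep′ b t t′ t≈t′ = dep _ _ λ { zero _ → refl ; (suc i) (s≤s i<M) → t≈t′ i i<M }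

rank-D-dependsOnPrefix : (s k : ℕ) → DependsOnPrefix (s + k ∸ 1) (λ t → rank (D s k t))
rank-D-dependsOnPrefix s k t t′ t≈t′ =
  cong rank (tabulate-cong (λ i → tabulate-cong (λ j → t≈t′ _ (i+j<s+k∸1 i j))))
  where
  i+j<s+k∸1 : (i : Fin s) (j : Fin k) → toℕ i + toℕ j < s + k ∸ 1
  i+j<s+k∸1 i j = NP.∸-monoˡ-≤ 1
    (subst (_≤ s + k) (NP.+-suc (suc (toℕ i)) (toℕ j)) (NP.+-mono-≤ (toℕ<n i) (toℕ<n j)))

∑-upTo-suc : (F : ℕ → ℕ) (n : ℕ) → Σℕ.∑ F (upTo (suc n)) ≡ F 0 + Σℕ.∑ (F ∘ suc) (upTo n)
∑-upTo-suc F n =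
  cong (F 0 +_) (trans (cong (Σℕ.∑ F) (sym (map-applyUpTo id suc n))) (Σℕ.∑-map F suc (upTo n)))

∑-upTo-select : (g : ℕ → ℕ) {v n : ℕ} → v < n → Σℕ.∑ (λ i → indicator (v ≡ᵇ i) * g i) (upTo n) ≡ g v
∑-upTo-select g {zero}  {suc n} _         =
  trans (∑-upTo-suc (λ i → indicator (0 ≡ᵇ i) * g i) n)
        (trans (cong (g 0 + 0 +_) (Σℕ.∑-zero (upTo n))) (trans (NP.+-identityʳ _) (NP.+-identityʳ _)))
∑-upTo-select g {suc v} {suc n} (s≤s v<n) =
  trans (∑-upTo-suc (λ i → indicator (suc v ≡ᵇ i) * g i) n) (∑-upTo-select (g ∘ suc) v<n)

∑-groupBy : {X : Set} (f : X → ℕ) (g : ℕ → ℕ) (n : ℕ) (xs : List X) → (∀ x → f x < n) →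
            Σℕ.∑ (g ∘ f) xs ≡ Σℕ.∑ (λ i → countB (λ x → f x ≡ᵇ i) xs * g i) (upTo n)
∑-groupBy f g n xs f<n = begin
  Σℕ.∑ (g ∘ f) xs
    ≡⟨ Σℕ.∑-cong (λ x → ∑-upTo-select g (f<n x)) xs ⟨
  Σℕ.∑ (λ x → Σℕ.∑ (λ i → indicator (f x ≡ᵇ i) * g i) (upTo n)) xs
    ≡⟨ Σℕ.∑-comm _ xs (upTo n) ⟩
  Σℕ.∑ (λ i → Σℕ.∑ (λ x → indicator (f x ≡ᵇ i) * g i) xs) (upTo n)
    ≡⟨ Σℕ.∑-cong (λ i → trans (Σℕ.∑-*ʳ (g i) (λ x → indicator (f x ≡ᵇ i)) xs)
                              (cong (_* g i) (sym (countB≡∑indicator (λ x → f x ≡ᵇ i) xs)))) (upTo n) ⟩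
  Σℕ.∑ (λ i → countB (λ x → f x ≡ᵇ i) xs * g i) (upTo n) ∎
  where open ≡-Reasoning

-- The character E and the Hankel matrix

open import Data.Integer using (+_)
open import Data.Rational as ℚ using (ℚ; _/_)
import Data.Rational.Properties as QP
import Data.Rational.Unnormalised as U
import Data.Rational.Unnormalised.Properties as UP

∑-+ : {X : Set} (f : X → ℕ) (xs : List X) → Σℤ.∑ (λ x → + f x) xs ≡ + Σℕ.∑ f xs
∑-+ f []       = refl
∑-+ f (x ∷ xs) = trans (cong (λ z → + f x ℤ.+ z) (∑-+ f xs)) (sym (ZP.pos-+ (f x) _))

pos-^ : ∀ m n → (+ m) ℤ.^ n ≡ + (m ^ n)
pos-^ m zero    = refl
pos-^ m (suc n) = trans (cong ((+ m) ℤ.*_) (pos-^ m n)) (sym (ZP.pos-* m (m ^ n)))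

∑-neg : {X : Set} (f : X → ℤ) (xs : List X) → Σℤ.∑ (λ x → ℤ.- f x) xs ≡ ℤ.- Σℤ.∑ f xs
∑-neg f []       = refl
∑-neg f (x ∷ xs) = trans (cong (λ z → ℤ.- f x ℤ.+ z) (∑-neg f xs)) (sym (ZP.neg-distrib-+ (f x) _))

open import Algebra.Properties.CommutativeSemigroup
  (CommutativeRing.+-commutativeSemigroup xor-∧-commutativeRing) using () renaming (interchange to xor-interchange)

-- χ b = (-1)^b, so that E t P ≡ χ (coeffNeg1 t P) holds by definition
χ : Bool → ℤ
χ b = if b then ℤ.- (+ 1) else + 1

χ-xor : ∀ a b → χ (a xor b) ≡ χ a ℤ.* χ b
χ-xor false b     = sym (ZP.*-identityˡ (χ b))
χ-xor true  false = refl
χ-xor true  true  = refl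

χ-not : ∀ b → χ (not b) ≡ ℤ.- χ b
χ-not false = refl
χ-not true  = refl

coeffNeg1From-suc : (t : ℙ) (j : ℕ) (P : Poly) → coeffNeg1From t (suc j) P ≡ coeffNeg1From (t ∘ suc) j P
coeffNeg1From-suc t j []      = refl
coeffNeg1From-suc t j (p ∷ P) = cong ((t (suc j) ∧ p) xor_) (coeffNeg1From-suc t (suc j) P)

coeffNeg1From-addP : (t : ℙ) (j : ℕ) (P Q : Poly) →
                     coeffNeg1From t j (addP P Q) ≡ coeffNeg1From t j P xor coeffNeg1From t j Q
coeffNeg1From-addP t j []      Q       = refl
coeffNeg1From-addP t j (p ∷ P) []      = sym (xor-identityʳ _)
coeffNeg1From-addP t j (p ∷ P) (q ∷ Q) = begin
  (t j ∧ (p xor q)) xor coeffNeg1From t (suc j) (addP P Q)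
    ≡⟨ cong₂ _xor_ (∧-distribˡ-xor (t j) p q) (coeffNeg1From-addP t (suc j) P Q) ⟩
  ((t j ∧ p) xor (t j ∧ q)) xor (coeffNeg1From t (suc j) P xor coeffNeg1From t (suc j) Q)
    ≡⟨ xor-interchange (t j ∧ p) (t j ∧ q) _ _ ⟩
  ((t j ∧ p) xor coeffNeg1From t (suc j) P) xor ((t j ∧ q) xor coeffNeg1From t (suc j) Q) ∎
  where open ≡-Reasoning

E-addP : (t : ℙ) (P Q : Poly) → E t (addP P Q) ≡ E t P ℤ.* E t Q
E-addP t P Q = trans (cong χ (coeffNeg1From-addP t 0 P Q)) (χ-xor (coeffNeg1 t P) (coeffNeg1 t Q))

-- negCoeffs t k P lists the coefficients of T^{-1}, …, T^{-k} in t·P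
negCoeffs : ℙ → (k : ℕ) → Poly → Vec Bool k
negCoeffs t k P = V.tabulate (λ i → coeffNeg1From t (toℕ i) P)

negCoeffs-∘suc : (t : ℙ) (k : ℕ) (P : Poly) →
                 negCoeffs (t ∘ suc) k P ≡ V.tabulate (λ i → coeffNeg1From t (suc (toℕ i)) P)
negCoeffs-∘suc t k P = tabulate-cong (λ i → sym (coeffNeg1From-suc t (toℕ i) P))

coeffNeg1From-zeroPoly : (t : ℙ) (j : ℕ) (P : Poly) → coeffNeg1From t j (map (const false) P) ≡ false
coeffNeg1From-zeroPoly t j []      = refl
coeffNeg1From-zeroPoly t j (p ∷ P) =
  trans (cong (_xor coeffNeg1From t (suc j) (map (const false) P)) (∧-zeroʳ (t j)))
        (coeffNeg1From-zeroPoly t (suc j) P)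

tabulate-false : (k : ℕ) → V.tabulate {n = k} (λ _ → false) ≡ zeros k
tabulate-false zero    = refl
tabulate-false (suc k) = cong (false ∷_) (tabulate-false k)

xorV-tabulate : {k : ℕ} (f g : Fin k → Bool) →
                xorV (V.tabulate f) (V.tabulate g) ≡ V.tabulate (λ i → f i xor g i)
xorV-tabulate {zero}  f g = refl
xorV-tabulate {suc k} f g = cong ((f zero xor g zero) ∷_) (xorV-tabulate (f ∘ suc) (g ∘ suc))

sumRows-D : (s k : ℕ) (t : ℙ) (Z : Vec Bool s) → sumRows Z (D s k t) ≡ negCoeffs t k (toPoly Z)
sumRows-D zero    k t []          = sym (tabulate-false k)
sumRows-D (suc s) k t (false ∷ Z) = begin
  sumRows Z (D s k (t ∘ suc))
    ≡⟨ sumRows-D s k (t ∘ suc) Z ⟩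
  negCoeffs (t ∘ suc) k (toPoly Z)
    ≡⟨ negCoeffs-∘suc t k (toPoly Z) ⟩
  V.tabulate (λ i → coeffNeg1From t (suc (toℕ i)) (toPoly Z))
    ≡⟨ tabulate-cong (λ i → cong (_xor coeffNeg1From t (suc (toℕ i)) (toPoly Z)) (∧-zeroʳ (t (toℕ i)))) ⟨
  negCoeffs t k (false ∷ toPoly Z) ∎
  where open ≡-Reasoning
sumRows-D (suc s) k t (true ∷ Z)  = begin
  xorV (V.tabulate (t ∘ toℕ)) (sumRows Z (D s k (t ∘ suc)))
    ≡⟨ cong (xorV (V.tabulate (t ∘ toℕ))) (trans (sumRows-D s k (t ∘ suc) Z) (negCoeffs-∘suc t k (toPoly Z))) ⟩
  xorV (V.tabulate (t ∘ toℕ)) (V.tabulate (λ i → coeffNeg1From t (suc (toℕ i)) (toPoly Z)))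
    ≡⟨ xorV-tabulate _ _ ⟩
  V.tabulate (λ i → t (toℕ i) xor coeffNeg1From t (suc (toℕ i)) (toPoly Z))
    ≡⟨ tabulate-cong (λ i → cong (_xor coeffNeg1From t (suc (toℕ i)) (toPoly Z)) (∧-identityʳ (t (toℕ i)))) ⟨
  negCoeffs t k (true ∷ toPoly Z)
    ∎
  where open ≡-Reasoning

-- coeffNeg1 (ext Y) Q is the 𝔽₂-pairing of Y with the coefficient vector Q
coeffNeg1-mulP : {k : ℕ} (t : ℙ) (Y : Vec Bool k) (P : Poly) →
                 coeffNeg1 t (mulP (toPoly Y) P) ≡ coeffNeg1 (ext Y) (toPoly (negCoeffs t k P))
coeffNeg1-mulP t []      P = refl
coeffNeg1-mulP {suc k} t (y ∷ Y) P = begin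
  coeffNeg1 t (addP (y·P y) (false ∷ YP))
    ≡⟨ coeffNeg1From-addP t 0 (y·P y) (false ∷ YP) ⟩
  coeffNeg1 t (y·P y) xor ((t 0 ∧ false) xor coeffNeg1From t 1 YP)
    ≡⟨ cong₂ _xor_ (coeffNeg1-y·P y) (cong (_xor coeffNeg1From t 1 YP) (∧-zeroʳ (t 0))) ⟩
  c xor coeffNeg1From t 1 YP
    ≡⟨ cong (c xor_) (trans (coeffNeg1From-suc t 0 YP) (coeffNeg1-mulP (t ∘ suc) Y P)) ⟩
  c xor coeffNeg1 (ext Y) (toPoly (negCoeffs (t ∘ suc) k P))
    ≡⟨ cong (λ v → c xor coeffNeg1 (ext Y) (toPoly v)) (negCoeffs-∘suc t k P) ⟩
  c xor coeffNeg1 (ext Y) (toPoly tP)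
    ≡⟨ cong (c xor_) (coeffNeg1From-suc (ext (y ∷ Y)) 0 (toPoly tP)) ⟨
  coeffNeg1 (ext (y ∷ Y)) (toPoly (negCoeffs t (suc k) P)) ∎
  where
  open ≡-Reasoning
  YP = mulP (toPoly Y) P
  c  = y ∧ coeffNeg1 t P
  tP = V.tabulate {n = k} (λ i → coeffNeg1From t (suc (toℕ i)) P)
  y·P : Bool → Poly
  y·P y = if y then P else map (const false) P
  coeffNeg1-y·P : ∀ y → coeffNeg1 t (y·P y) ≡ y ∧ coeffNeg1 t P
  coeffNeg1-y·P true  = refl
  coeffNeg1-y·P false = coeffNeg1From-zeroPoly t 0 P

E-mulP-Hankel : (s k : ℕ) (t : ℙ) (Y : Vec Bool k) (Z : Vec Bool s) →
                E t (mulP (toPoly Y) (toPoly Z)) ≡ E (ext Y) (toPoly (sumRows Z (D s k t)))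
E-mulP-Hankel s k t Y Z =
  cong χ (trans (coeffNeg1-mulP t Y (toPoly Z)) (cong (coeffNeg1 (ext Y) ∘ toPoly) (sym (sumRows-D s k t Z))))

∑-E-ext : (N : ℕ) (P : Poly) → length P ≤ N →
          Σℤ.∑ (λ α → E (ext α) P) (allVec N) ≡ + (2 ^ N * indicator (isZeroP P))
∑-E-ext N       []          _           = trans (∑-+ (λ _ → 1) (allVec N)) (cong +_ (∑-allVec-const N 1))
∑-E-ext (suc N) (false ∷ P) (s≤s ∣P∣≤N) = begin
  Σℤ.∑ (λ α → E (ext α) (false ∷ P)) (allVec (suc N))
    ≡⟨ Σℤ.∑-allVec-suc {N} (λ α → E (ext α) (false ∷ P)) ⟩
  Σℤ.∑ (λ α → χ (coeffNeg1From (ext (false ∷ α)) 1 P)) (allVec N)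
    ℤ.+ Σℤ.∑ (λ α → χ (coeffNeg1From (ext (true ∷ α)) 1 P)) (allVec N)
    ≡⟨ cong₂ ℤ._+_ (Σℤ.∑-cong (λ α → cong χ (coeffNeg1From-suc (ext (false ∷ α)) 0 P)) (allVec N))
                   (Σℤ.∑-cong (λ α → cong χ (coeffNeg1From-suc (ext (true ∷ α)) 0 P)) (allVec N)) ⟩
  X ℤ.+ X
    ≡⟨ cong₂ ℤ._+_ (∑-E-ext N P ∣P∣≤N) (∑-E-ext N P ∣P∣≤N) ⟩
  + (2 ^ N * i) ℤ.+ + (2 ^ N * i)
    ≡⟨ trans (cong +_ (2^suc*≡ N i)) (ZP.pos-+ (2 ^ N * i) (2 ^ N * i)) ⟨
  + (2 ^ suc N * i) ∎
  where
  open ≡-Reasoning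
  X = Σℤ.∑ (λ α → E (ext α) P) (allVec N)
  i = indicator (isZeroP P)
∑-E-ext (suc N) (true ∷ P)  (s≤s ∣P∣≤N) = begin
  Σℤ.∑ (λ α → E (ext α) (true ∷ P)) (allVec (suc N))
    ≡⟨ Σℤ.∑-allVec-suc {N} (λ α → E (ext α) (true ∷ P)) ⟩
  Σℤ.∑ (λ α → χ (coeffNeg1From (ext (false ∷ α)) 1 P)) (allVec N)
    ℤ.+ Σℤ.∑ (λ α → χ (not (coeffNeg1From (ext (true ∷ α)) 1 P))) (allVec N)
    ≡⟨ cong₂ ℤ._+_ (Σℤ.∑-cong (λ α → cong χ (coeffNeg1From-suc (ext (false ∷ α)) 0 P)) (allVec N))
                   (Σℤ.∑-cong (λ α → trans (cong (χ ∘ not) (coeffNeg1From-suc (ext (true ∷ α)) 0 P))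
                                            (χ-not (coeffNeg1 (ext α) P))) (allVec N)) ⟩
  X ℤ.+ Σℤ.∑ (λ α → ℤ.- E (ext α) P) (allVec N)
    ≡⟨ cong (λ z → X ℤ.+ z) (∑-neg (λ α → E (ext α) P) (allVec N)) ⟩
  X ℤ.+ ℤ.- X
    ≡⟨ ZP.+-inverseʳ X ⟩
  + 0
    ≡⟨ cong +_ (NP.*-zeroʳ (2 ^ suc N)) ⟨
  + (2 ^ suc N * 0) ∎
  where
  open ≡-Reasoning
  X = Σℤ.∑ (λ α → E (ext α) P) (allVec N)

h≡2^k*kernelSize : (s k : ℕ) (t : ℙ) → h s k t ≡ + (2 ^ k * kernelSize (D s k t))
h≡2^k*kernelSize s k t = begin
  h s k t
    ≡⟨ Σℤ.sum-concatMap _ (allVec k) ⟩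
  Σℤ.∑ (λ Y → Σℤ.∑ (λ Z → E t (mulP (toPoly Y) (toPoly Z))) (allVec s)) (allVec k)
    ≡⟨ Σℤ.∑-cong (λ Y → Σℤ.∑-cong (E-mulP-Hankel s k t Y) (allVec s)) (allVec k) ⟩
  Σℤ.∑ (λ Y → Σℤ.∑ (λ Z → E (ext Y) (toPoly (Z·D Z))) (allVec s)) (allVec k)
    ≡⟨ Σℤ.∑-comm (λ Y Z → E (ext Y) (toPoly (Z·D Z))) (allVec k) (allVec s) ⟩
  Σℤ.∑ (λ Z → Σℤ.∑ (λ Y → E (ext Y) (toPoly (Z·D Z))) (allVec k)) (allVec s)
    ≡⟨ Σℤ.∑-cong (λ Z → ∑-E-ext k (toPoly (Z·D Z)) (NP.≤-reflexive (length-toList (Z·D Z)))) (allVec s) ⟩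
  Σℤ.∑ (λ Z → + (2 ^ k * indicator (isZeroV (Z·D Z)))) (allVec s)
    ≡⟨ ∑-+ (λ Z → 2 ^ k * indicator (isZeroV (Z·D Z))) (allVec s) ⟩
  + Σℕ.∑ (λ Z → 2 ^ k * indicator (isZeroV (Z·D Z))) (allVec s)
    ≡⟨ cong +_ (Σℕ.∑-*ˡ (2 ^ k) (λ Z → indicator (isZeroV (Z·D Z))) (allVec s)) ⟩
  + (2 ^ k * Σℕ.∑ (λ Z → indicator (isZeroV (Z·D Z))) (allVec s))
    ≡⟨ cong (λ n → + (2 ^ k * n))
            (Σℕ.∑-cong (λ Z → cong (indicator ∘ isZeroV) (sym (xorV-identityʳ (Z·D Z)))) (allVec s)) ⟩
  + (2 ^ k * kernelSize (D s k t)) ∎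
  where
  open ≡-Reasoning
  Z·D : Vec Bool s → Vec Bool k
  Z·D Z = sumRows Z (D s k t)

h≡2^[k+s∸rank] : (s k : ℕ) (t : ℙ) → h s k t ≡ + (2 ^ (k + s ∸ rank (D s k t)))
h≡2^[k+s∸rank] s k t = trans (h≡2^k*kernelSize s k t) (cong +_ (begin
  2 ^ k * kernelSize (D s k t)       ≡⟨ cong (2 ^ k *_) (kernelSize≡2^[a∸rank] (D s k t)) ⟩
  2 ^ k * 2 ^ (s ∸ rank (D s k t))   ≡⟨ NP.^-distribˡ-+-* 2 k (s ∸ rank (D s k t)) ⟨
  2 ^ (k + (s ∸ rank (D s k t)))     ≡⟨ cong (2 ^_) (NP.+-∸-assoc k (rank≤rows (D s k t))) ⟨
  2 ^ (k + s ∸ rank (D s k t))       ∎))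
  where open ≡-Reasoning

-- The moments of h

∏ : {X : Set} {q : ℕ} → (X → ℤ) → Vec X q → ℤ
∏ f []      = + 1
∏ f (x ∷ v) = f x ℤ.* ∏ f v

∑-^ : {X : Set} (f : X → ℤ) (xs : List X) (q : ℕ) → Σℤ.∑ f xs ℤ.^ q ≡ Σℤ.∑ (∏ f) (allVecOf xs q)
∑-^ f xs zero    = refl
∑-^ f xs (suc q) = begin
  Σℤ.∑ f xs ℤ.* Σℤ.∑ f xs ℤ.^ q
    ≡⟨ cong (Σℤ.∑ f xs ℤ.*_) (∑-^ f xs q) ⟩
  Σℤ.∑ f xs ℤ.* S
    ≡⟨ Σℤ.∑-*ʳ S f xs ⟨
  Σℤ.∑ (λ x → f x ℤ.* S) xs
    ≡⟨ Σℤ.∑-cong (λ x → Σℤ.∑-*ˡ (f x) (∏ f) (allVecOf xs q)) xs ⟨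
  Σℤ.∑ (λ x → Σℤ.∑ (λ v → f x ℤ.* ∏ f v) (allVecOf xs q)) xs
    ≡⟨ Σℤ.∑-cong (λ x → Σℤ.∑-map (∏ f) (x ∷_) (allVecOf xs q)) xs ⟨
  Σℤ.∑ (λ x → Σℤ.∑ (∏ f) (map (x ∷_) (allVecOf xs q))) xs
    ≡⟨ Σℤ.∑-concatMap (∏ f) (λ x → map (x ∷_) (allVecOf xs q)) xs ⟨
  Σℤ.∑ (∏ f) (allVecOf xs (suc q)) ∎
  where
  open ≡-Reasoning
  S = Σℤ.∑ (∏ f) (allVecOf xs q)

E-product : {s k : ℕ} → ℙ → Vec Bool k × Vec Bool s → ℤ
E-product t (Y , Z) = E t (mulP (toPoly Y) (toPoly Z))

∏-E-product : {s k q : ℕ} (t : ℙ) (v : Vec (Vec Bool k × Vec Bool s) q) →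
              ∏ (E-product t) v ≡ E t (sumProds v)
∏-E-product t []            = refl
∏-E-product t ((Y , Z) ∷ v) =
  trans (cong (E-product t (Y , Z) ℤ.*_) (∏-E-product t v)) (sym (E-addP t (mulP (toPoly Y) (toPoly Z)) (sumProds v)))

h≡∑-E-product : (s k : ℕ) (t : ℙ) → h s k t ≡ Σℤ.∑ (E-product t) (cartesianProduct (allVec k) (allVec s))
h≡∑-E-product s k t =
  trans (Σℤ.sum-concatMap _ (allVec k)) (sym (Σℤ.∑-cartesianProduct (E-product t) (allVec k) (allVec s)))

length-addP : (m : ℕ) (P Q : Poly) → length P ≤ m → length Q ≤ m → length (addP P Q) ≤ m
length-addP m       []      Q       _           ∣Q∣≤m       = ∣Q∣≤m
length-addP m       (p ∷ P) []      ∣P∣≤m       _           = ∣P∣≤m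
length-addP (suc m) (p ∷ P) (q ∷ Q) (s≤s ∣P∣≤m) (s≤s ∣Q∣≤m) = s≤s (length-addP m P Q ∣P∣≤m ∣Q∣≤m)

length-mulP : (P : Poly) (z : Bool) (Q : Poly) → length (mulP P (z ∷ Q)) ≤ length P + length Q
length-mulP []      z Q = z≤n
length-mulP (y ∷ P) z Q =
  length-addP _ (y·zQ y) (false ∷ mulP P (z ∷ Q)) (length-y·zQ y) (s≤s (length-mulP P z Q))
  where
  y·zQ : Bool → Poly
  y·zQ y = if y then z ∷ Q else map (const false) (z ∷ Q)
  length-y·zQ : ∀ y → length (y·zQ y) ≤ suc (length P + length Q)
  length-y·zQ true  = s≤s (NP.m≤n+m (length Q) (length P))
  length-y·zQ false = s≤s (NP.≤-trans (NP.≤-reflexive (length-map (const false) Q)) (NP.m≤n+m (length Q) (length P)))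

length-sumProds : {s k q : ℕ} (v : Vec (Vec Bool k × Vec Bool (suc s)) q) → length (sumProds v) ≤ k + s
length-sumProds []                      = z≤n
length-sumProds {s} {k} ((Y , z ∷ Z) ∷ v) = length-addP _ (mulP (toPoly Y) (z ∷ toPoly Z)) (sumProds v)
  (subst₂ (λ m n → length (mulP (toPoly Y) (z ∷ toPoly Z)) ≤ m + n) (length-toList Y) (length-toList Z)
          (length-mulP (toPoly Y) z (toPoly Z)))
  (length-sumProds v)

-- expanding h^q and summing over t first leaves only the tuples with Σ YᵢZᵢ = 0
∑-h^q≡2^N*R : (s k q N : ℕ) → k + s ≤ N →
              Σℤ.∑ (λ α → h (suc s) k (ext α) ℤ.^ q) (allVec N) ≡ + (2 ^ N * R (suc s) k q)
∑-h^q≡2^N*R s k q N k+s≤N = begin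
  Σℤ.∑ (λ α → h (suc s) k (ext α) ℤ.^ q) (allVec N)
    ≡⟨ Σℤ.∑-cong (λ α → trans (cong (ℤ._^ q) (h≡∑-E-product (suc s) k (ext α)))
                              (∑-^ (E-product (ext α)) pairs q)) (allVec N) ⟩
  Σℤ.∑ (λ α → Σℤ.∑ (∏ (E-product (ext α))) tuples) (allVec N)
    ≡⟨ Σℤ.∑-cong (λ α → Σℤ.∑-cong (∏-E-product (ext α)) tuples) (allVec N) ⟩
  Σℤ.∑ (λ α → Σℤ.∑ (λ v → E (ext α) (sumProds v)) tuples) (allVec N)
    ≡⟨ Σℤ.∑-comm (λ α v → E (ext α) (sumProds v)) (allVec N) tuples ⟩
  Σℤ.∑ (λ v → Σℤ.∑ (λ α → E (ext α) (sumProds v)) (allVec N)) tuples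
    ≡⟨ Σℤ.∑-cong (λ v → ∑-E-ext N (sumProds v) (NP.≤-trans (length-sumProds v) k+s≤N)) tuples ⟩
  Σℤ.∑ (λ v → + (2 ^ N * indicator (isZeroP (sumProds v)))) tuples
    ≡⟨ ∑-+ (λ v → 2 ^ N * indicator (isZeroP (sumProds v))) tuples ⟩
  + Σℕ.∑ (λ v → 2 ^ N * indicator (isZeroP (sumProds v))) tuples
    ≡⟨ cong +_ (Σℕ.∑-*ˡ (2 ^ N) (λ v → indicator (isZeroP (sumProds v))) tuples) ⟩
  + (2 ^ N * Σℕ.∑ (λ v → indicator (isZeroP (sumProds v))) tuples)
    ≡⟨ cong (λ n → + (2 ^ N * n)) (countB≡∑indicator (isZeroP ∘ sumProds) tuples) ⟨
  + (2 ^ N * R (suc s) k q) ∎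
  where
  open ≡-Reasoning
  pairs  = cartesianProduct (allVec k) (allVec (suc s))
  tuples = allVecOf pairs q

/-cong-crossMul : (a c b d : ℕ) .{{_ : NonZero b}} .{{_ : NonZero d}} → a * d ≡ c * b → (+ a) / b ≡ (+ c) / d
/-cong-crossMul a c (suc b) (suc d) ad≡cb = QP.fromℚᵘ-cong {U.mkℚᵘ (+ a) b} {U.mkℚᵘ (+ c) d}
  (U.*≡* (trans (sym (ZP.pos-* a (suc d))) (trans (cong +_ ad≡cb) (ZP.pos-* c (suc b)))))

/-distribʳ-+ : (a c d : ℕ) .{{_ : NonZero d}} → (+ a) / d ℚ.+ (+ c) / d ≡ (+ (a + c)) / d
/-distribʳ-+ a c d@(suc d-1) = QP.toℚᵘ-injective (UP.≃-trans (QP.toℚᵘ-homo-+ ((+ a) / d) ((+ c) / d))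
  (UP.≃-trans (UP.+-cong (QP.toℚᵘ-fromℚᵘ (U.mkℚᵘ (+ a) d-1)) (QP.toℚᵘ-fromℚᵘ (U.mkℚᵘ (+ c) d-1)))
  (UP.≃-trans unnormalised (UP.≃-sym (QP.toℚᵘ-fromℚᵘ (U.mkℚᵘ (+ (a + c)) d-1))))))
  where
  unnormalised : U.mkℚᵘ (+ a) d-1 U.+ U.mkℚᵘ (+ c) d-1 U.≃ U.mkℚᵘ (+ (a + c)) d-1
  unnormalised = U.*≡* (begin
    (+ a ℤ.* + d ℤ.+ + c ℤ.* + d) ℤ.* + d  ≡⟨ cong (ℤ._* + d) (cong₂ ℤ._+_ (ZP.pos-* a d) (ZP.pos-* c d)) ⟨
    (+ (a * d) ℤ.+ + (c * d)) ℤ.* + d      ≡⟨ cong (ℤ._* + d) (ZP.pos-+ (a * d) (c * d)) ⟨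
    + (a * d + c * d) ℤ.* + d              ≡⟨ ZP.pos-* (a * d + c * d) d ⟨
    + ((a * d + c * d) * d)                ≡⟨ cong +_ (trans (sym (NP.*-assoc (a + c) d d)) (cong (_* d) (NP.*-distribʳ-+ d a c))) ⟨
    + ((a + c) * (d * d))                  ≡⟨ ZP.pos-* (a + c) (d * d) ⟩
    + (a + c) ℤ.* + (d * d)                ∎)
    where open ≡-Reasoning

R≡∫h^q : (s k q N : ℕ) → k + suc s ∸ 1 ≤ N → (+ R (suc s) k q) / 1 ≡ ∫ℙ[ N ] (λ t → h (suc s) k t ℤ.^ q)
R≡∫h^q s k q N k+s≤N =
  trans (/-cong-crossMul (R (suc s) k q) (2 ^ N * R (suc s) k q) 1 (2 ^ N)
                         (trans (NP.*-comm (R (suc s) k q) (2 ^ N)) (sym (NP.*-identityʳ _))))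
        (cong (λ i → i / 2 ^ N) (sym (∑-h^q≡2^N*R s k q N (subst (_≤ N) (cong (_∸ 1) (NP.+-suc k s)) k+s≤N))))
  where instance _ = NP.m^n≢0 2 N

sumℚ-/ : (xs : List ℕ) (r : ℕ → ℚ) (c : ℕ → ℕ) (d : ℕ) .{{_ : NonZero d}} →
         (∀ {i} → i ∈ xs → r i ≡ (+ c i) / d) → sumℚ (map r xs) ≡ (+ Σℕ.∑ c xs) / d
sumℚ-/ []       r c d _  = sym (QP.0/n≡0 d)
sumℚ-/ (x ∷ xs) r c d r≡ =
  trans (cong₂ ℚ._+_ (r≡ (here refl)) (sumℚ-/ xs r c d (r≡ ∘ there))) (/-distribʳ-+ (c x) (Σℕ.∑ c xs) d)

rhs-exponent : (q s k i : ℕ) → i ≤ suc s →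
               q * (k + suc s) + 1 + (suc s + k ∸ 1) ≡ (k + suc s ∸ i) * suc q + suc q * i
rhs-exponent q s k i i≤1+s = begin
  q * n + 1 + (s + k)             ≡⟨ NP.+-assoc (q * n) 1 (s + k) ⟩
  q * n + suc (s + k)             ≡⟨ cong (λ x → q * n + x) (trans (cong suc (NP.+-comm s k)) (sym (NP.+-suc k s))) ⟩
  q * n + n                       ≡⟨ NP.+-comm (q * n) n ⟩
  suc q * n                       ≡⟨ cong (suc q *_) (NP.m∸n+n≡m i≤n) ⟨
  suc q * (n ∸ i + i)             ≡⟨ NP.*-distribˡ-+ (suc q) (n ∸ i) i ⟩
  suc q * (n ∸ i) + suc q * i     ≡⟨ cong (_+ suc q * i) (NP.*-comm (suc q) (n ∸ i)) ⟩
  (n ∸ i) * suc q + suc q * i     ∎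
  where
  open ≡-Reasoning
  n = k + suc s
  i≤n : i ≤ n
  i≤n = NP.≤-trans i≤1+s (NP.m≤n+m (suc s) k)

-- the i-th term of rhs, put over the common denominator 2^{s+k-1}
rhs-term : (q s k i : ℕ) → i ≤ suc s →
  _/_ (+ (2 ^ ((suc q ∸ 1) * (k + suc s) + 1) * Γ i (suc s) k)) (2 ^ (suc q * i)) {{NP.m^n≢0 2 (suc q * i)}}
  ≡ _/_ (+ (Γ i (suc s) k * (2 ^ (k + suc s ∸ i)) ^ suc q)) (2 ^ (suc s + k ∸ 1)) {{NP.m^n≢0 2 (suc s + k ∸ 1)}}
rhs-term q s k i i≤1+s =
  /-cong-crossMul (2 ^ e * γ) (γ * (2 ^ (n ∸ i)) ^ suc q) (2 ^ (suc q * i)) (2 ^ m)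
                  {{NP.m^n≢0 2 (suc q * i)}} {{NP.m^n≢0 2 m}} (begin
    2 ^ e * γ * 2 ^ m                                 ≡⟨ cong (_* 2 ^ m) (NP.*-comm (2 ^ e) γ) ⟩
    γ * 2 ^ e * 2 ^ m                                 ≡⟨ NP.*-assoc γ (2 ^ e) (2 ^ m) ⟩
    γ * (2 ^ e * 2 ^ m)                               ≡⟨ cong (γ *_) (NP.^-distribˡ-+-* 2 e m) ⟨
    γ * 2 ^ (e + m)                                   ≡⟨ cong (λ x → γ * 2 ^ x) (rhs-exponent q s k i i≤1+s) ⟩
    γ * 2 ^ ((n ∸ i) * suc q + suc q * i)             ≡⟨ cong (γ *_) (NP.^-distribˡ-+-* 2 ((n ∸ i) * suc q) (suc q * i)) ⟩
    γ * (2 ^ ((n ∸ i) * suc q) * 2 ^ (suc q * i))     ≡⟨ cong (λ x → γ * (x * 2 ^ (suc q * i))) (NP.^-*-assoc 2 (n ∸ i) (suc q)) ⟨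
    γ * ((2 ^ (n ∸ i)) ^ suc q * 2 ^ (suc q * i))     ≡⟨ NP.*-assoc γ _ _ ⟨
    γ * (2 ^ (n ∸ i)) ^ suc q * 2 ^ (suc q * i)       ∎)
  where
  open ≡-Reasoning
  n = k + suc s
  e = q * n + 1
  m = suc s + k ∸ 1
  γ = Γ i (suc s) k

/-cancel-2^ : (x m N : ℕ) → m ≤ N →
  _/_ (+ (2 ^ (N ∸ m) * x)) (2 ^ N) {{NP.m^n≢0 2 N}} ≡ _/_ (+ x) (2 ^ m) {{NP.m^n≢0 2 m}}
/-cancel-2^ x m N m≤N = /-cong-crossMul (2 ^ (N ∸ m) * x) x (2 ^ N) (2 ^ m) {{NP.m^n≢0 2 N}} {{NP.m^n≢0 2 m}} (begin
  2 ^ (N ∸ m) * x * 2 ^ m     ≡⟨ cong (_* 2 ^ m) (NP.*-comm (2 ^ (N ∸ m)) x) ⟩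
  x * 2 ^ (N ∸ m) * 2 ^ m     ≡⟨ NP.*-assoc x _ _ ⟩
  x * (2 ^ (N ∸ m) * 2 ^ m)   ≡⟨ cong (x *_) (NP.^-distribˡ-+-* 2 (N ∸ m) m) ⟨
  x * 2 ^ (N ∸ m + m)         ≡⟨ cong (λ e → x * 2 ^ e) (NP.m∸n+n≡m m≤N) ⟩
  x * 2 ^ N                   ∎)
  where open ≡-Reasoning

∑-h^q≡∑-rank : (s k q N : ℕ) → s + k ∸ 1 ≤ N →
  Σℤ.∑ (λ α → h s k (ext α) ℤ.^ q) (allVec N)
  ≡ + (2 ^ (N ∸ (s + k ∸ 1)) * Σℕ.∑ (λ α → (2 ^ (k + s ∸ rank (D s k (ext α)))) ^ q) (allVec (s + k ∸ 1)))
∑-h^q≡∑-rank s k q N m≤N = begin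
  Σℤ.∑ (λ α → h s k (ext α) ℤ.^ q) (allVec N)
    ≡⟨ Σℤ.∑-cong (λ α → trans (cong (ℤ._^ q) (h≡2^[k+s∸rank] s k (ext α))) (pos-^ _ q)) (allVec N) ⟩
  Σℤ.∑ (λ α → + g (rank (D s k (ext α)))) (allVec N)
    ≡⟨ ∑-+ (λ α → g (rank (D s k (ext α)))) (allVec N) ⟩
  + Σℕ.∑ (λ α → g (rank (D s k (ext α)))) (allVec N)
    ≡⟨ cong +_ (∑-allVec-prefix (s + k ∸ 1) (g ∘ rank ∘ D s k) g∘rank-dependsOnPrefix N m≤N) ⟩
  + (2 ^ (N ∸ (s + k ∸ 1)) * Σℕ.∑ (λ α → g (rank (D s k (ext α)))) (allVec (s + k ∸ 1))) ∎
  where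
  open ≡-Reasoning
  g : ℕ → ℕ
  g i = (2 ^ (k + s ∸ i)) ^ q
  g∘rank-dependsOnPrefix : DependsOnPrefix (s + k ∸ 1) (g ∘ rank ∘ D s k)
  g∘rank-dependsOnPrefix t t′ t≈t′ = cong g (rank-D-dependsOnPrefix s k t t′ t≈t′)

∫h^q≡rhs : (s k q N : ℕ) → k + suc s ∸ 1 ≤ N → ∫ℙ[ N ] (λ t → h (suc s) k t ℤ.^ suc q) ≡ rhs (suc s) k (suc q)
∫h^q≡rhs s k q N k+s∸1≤N = begin
  _/_ (Σℤ.∑ (λ α → h S k (ext α) ℤ.^ suc q) (allVec N)) (2 ^ N) {{NP.m^n≢0 2 N}}
    ≡⟨ cong (λ i → _/_ i (2 ^ N) {{NP.m^n≢0 2 N}}) (∑-h^q≡∑-rank S k (suc q) N m≤N) ⟩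
  _/_ (+ (2 ^ (N ∸ m) * Σℕ.∑ (g ∘ r) (allVec m))) (2 ^ N) {{NP.m^n≢0 2 N}}
    ≡⟨ /-cancel-2^ (Σℕ.∑ (g ∘ r) (allVec m)) m N m≤N ⟩
  _/_ (+ Σℕ.∑ (g ∘ r) (allVec m)) (2 ^ m) {{NP.m^n≢0 2 m}}
    ≡⟨ cong (λ x → _/_ (+ x) (2 ^ m) {{NP.m^n≢0 2 m}}) (∑-groupBy r g (suc S) (allVec m) r<1+S) ⟩
  _/_ (+ Σℕ.∑ (λ i → Γ i S k * g i) (upTo (suc S))) (2 ^ m) {{NP.m^n≢0 2 m}}
    ≡⟨ sumℚ-/ (upTo (suc S)) _ (λ i → Γ i S k * g i) (2 ^ m) {{NP.m^n≢0 2 m}}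
              (λ i∈ → rhs-term q s k _ (NP.≤-pred (∈-upTo⁻ i∈))) ⟨
  rhs S k (suc q) ∎
  where
  open ≡-Reasoning
  S = suc s
  m = S + k ∸ 1
  r : Vec Bool m → ℕ
  r α = rank (D S k (ext α))
  g : ℕ → ℕ
  g i = (2 ^ (k + S ∸ i)) ^ suc q
  r<1+S : ∀ α → r α < suc S
  r<1+S α = s≤s (rank≤rows (D S k (ext α)))
  m≤N : m ≤ N
  m≤N = subst (_≤ N) (trans (cong (_∸ 1) (NP.+-suc k s)) (NP.+-comm k s)) k+s∸1≤N

-- the proof does not use the hypothesis 1 ≤ k
theorem1p4 : (s k q : ℕ) → 1 ≤ s → 1 ≤ k → 1 ≤ q →
    ((t : ℙ) → h s k t ≡ + (2 ^ (k + s ∸ rank (D s k t))))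
    × ((N : ℕ) → k + s ∸ 1 ≤ N → ∫ℙ[ N ] (λ t → h s k t ℤ.^ q) ≡ rhs s k q)
    × ((N : ℕ) → k + s ∸ 1 ≤ N → (+ R s k q) / 1 ≡ ∫ℙ[ N ] (λ t → h s k t ℤ.^ q))
theorem1p4 (suc s) k (suc q) _ _ _ = h≡2^[k+s∸rank] (suc s) k , ∫h^q≡rhs s k q , R≡∫h^q s k (suc q)
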